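{- Let $P, Q \in \mathbb{Z}[x_1^{\pm1},\ldots,x_n^{\pm1}]$. If $P/Q$ has the Gauss property, then $N(P) \subseteq N(Q)$.
   Context: For $Q=\sum_{\boldsymbol{k}} q_{\boldsymbol{k}}\boldsymbol{x}^{\boldsymbol{k}}\in\mathbb{Z}[\boldsymbol{x}^{\pm1}]$, its support is the set of $\boldsymbol{k}$ with $q_{\boldsymbol{k}}\ne0$, and $N(Q)$ (the Newton polytope) is the convex hull of the support. For a vertex $\boldsymbol{v}$ of $N(Q)$, expand $\boldsymbol{x}^{\boldsymbol{v}}/Q = \frac{1}{q_{\boldsymbol{v}}}\sum_{m\ge0}\big(-\sum_{\boldsymbol{k}\neq\boldsymbol{v}}\frac{q_{\boldsymbol{k}}}{q_{\boldsymbol{v}}}\boldsymbol{x}^{\boldsymbol{k}-\boldsymbol{v}}\big)^m$ as a formal Laurent series (well defined, supported in the proper cone generated by $N(Q/\boldsymbol{x}^{\boldsymbol{v}})$) and multiply by $P/\boldsymbol{x}^{\boldsymbol{v}}$; this is the Laurent series expansion of $P/Q$ with respect to $\boldsymbol{v}$. A formal Laurent series $f=\sum f_{\boldsymbol{k}}\boldsymbol{x}^{\boldsymbol{k}}$ with rational coefficients satisfies the Gauss congruences for the prime $p$ if all $f_{\boldsymbol{k}}\in\mathbb{Z}_p$ and $f_{\boldsymbol{m}p^r}\equiv f_{\boldsymbol{m}p^{r-1}}\pmod{p^r}$ for all $\boldsymbol{m}\in\mathbb{Z}^n$, $r\ge1$; it has the Gauss property if this holds for all but finitely many primes. The rational function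 $P/Q$ has the Gauss property if for every vertex $\boldsymbol{v}$ of $N(Q)$ its Laurent series expansion with respect to $\boldsymbol{v}$ has the Gauss property. -}

module Defs where

open import Data.Nat as ℕ using (ℕ; zero; suc)
open import Data.Nat.Primality using (Prime)
open import Data.Integer as ℤ using (ℤ; +_)
open import Data.Integer.Divisibility as ℤDiv using ()
open import Data.Nat.Divisibility as ℕDiv using ()
open import Data.Rational as ℚ using (ℚ; 0ℚ; 1ℚ; ↥_; ↧ₙ_; _/_)
open import Data.Rational.Properties as ℚP using ()
open import Data.Vec as Vec using (Vec; zipWith; replicate)
open import Data.Vec.Properties using (≡-dec)
open import Data.List as List using (List; []; _∷_; _++_; map; concatMap; foldr; filter)
open import Data.List.Relation.Unary.All using (All)
open import Data.Product using (Σ; ∃; ∃-syntax; _×_; _,_; proj₁; proj₂)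
open import Relation.Nullary using (¬_; Dec; yes; no)
open import Relation.Nullary.Decidable using (⌊_⌋; ¬?)
open import Relation.Binary.PropositionalEquality using (_≡_; _≢_)
open import Data.Bool using (if_then_else_)

Exp : ℕ → Set
Exp n = Vec ℤ n

_≟ₑ_ : ∀ {n} (a b : Exp n) → Dec (a ≡ b)
_≟ₑ_ = ≡-dec ℤ._≟_

_-ₑ_ : ∀ {n} → Exp n → Exp n → Exp n
_-ₑ_ = zipWith ℤ._-_

_+ₑ_ : ∀ {n} → Exp n → Exp n → Exp n
_+ₑ_ = zipWith ℤ._+_

_·ₑ_ : ∀ {n} → ℕ → Exp n → Exp n
s ·ₑ m = Vec.map (λ z → (+ s) ℤ.* z) m

-- A Laurent polynomial in ℤ[x₁^{±1},…,xₙ^{±1}] is a finite formal sum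
-- of monomials  c · x^k  (repetitions allowed; coefficients are added).
LaurentPoly : ℕ → Set
LaurentPoly n = List (Exp n × ℤ)

coeff : ∀ {n} → LaurentPoly n → Exp n → ℤ
coeff [] k = + 0
coeff ((e , c) ∷ ts) k with e ≟ₑ k
... | yes _ = c ℤ.+ coeff ts k
... | no  _ = coeff ts k

InSupport : ∀ {n} → LaurentPoly n → Exp n → Set
InSupport P k = coeff P k ≢ + 0

IsZeroPoly : ∀ {n} → LaurentPoly n → Set
IsZeroPoly P = ∀ k → coeff P k ≡ + 0

toℚ : ℤ → ℚ
toℚ z = z / 1

toℚᵛ : ∀ {n} → Exp n → Vec ℚ n
toℚᵛ = Vec.map toℚ

_+ᵛ_ : ∀ {n} → Vec ℚ n → Vec ℚ n → Vec ℚ n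
_+ᵛ_ = zipWith ℚ._+_

_·ᵛ_ : ∀ {n} → ℚ → Vec ℚ n → Vec ℚ n
t ·ᵛ x = Vec.map (t ℚ.*_) x

combo : ∀ {n} → List (Exp n × ℚ) → Vec ℚ n
combo {n} = foldr (λ { (k , w) acc → (w ·ᵛ toℚᵛ k) +ᵛ acc }) (replicate n 0ℚ)

weightSum : ∀ {n} → List (Exp n × ℚ) → ℚ
weightSum = foldr (λ { (_ , w) acc → w ℚ.+ acc }) 0ℚ

InNewton : ∀ {n} → LaurentPoly n → Vec ℚ n → Set
InNewton {n} P x =
  ∃[ ws ] (All (λ kw → InSupport P (proj₁ kw) × 0ℚ ℚ.≤ proj₂ kw) ws
           × weightSum ws ≡ 1ℚ
           × combo ws ≡ x)

IsVertex : ∀ {n} → LaurentPoly n → Exp n → Set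
IsVertex Q v =
  InNewton Q (toℚᵛ v) ×
  (∀ a b t → InNewton Q a → InNewton Q b → 0ℚ ℚ.< t → t ℚ.< 1ℚ →
     toℚᵛ v ≡ (t ·ᵛ a) +ᵛ ((1ℚ ℚ.- t) ·ᵛ b) → a ≡ toℚᵛ v × b ≡ toℚᵛ v)

QPoly : ℕ → Set
QPoly n = List (Exp n × ℚ)

coeffℚ : ∀ {n} → QPoly n → Exp n → ℚ
coeffℚ [] k = 0ℚ
coeffℚ ((e , c) ∷ ts) k with e ≟ₑ k
... | yes _ = c ℚ.+ coeffℚ ts k
... | no  _ = coeffℚ ts k

mulQ : ∀ {n} → QPoly n → QPoly n → QPoly n
mulQ A B = concatMap (λ { (e , c) → map (λ { (f , d) → (e +ₑ f , c ℚ.* d) }) B }) A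

oneQ : ∀ {n} → QPoly n
oneQ {n} = (replicate n (+ 0) , 1ℚ) ∷ []

powQ : ∀ {n} → QPoly n → ℕ → QPoly n
powQ A zero    = oneQ
powQ A (suc m) = mulQ A (powQ A m)

geomQ : ∀ {n} → QPoly n → ℕ → QPoly n
geomQ A zero    = oneQ
geomQ A (suc M) = powQ A (suc M) ++ geomQ A M

-- total inverse on ℚ (only ever used at a nonzero argument, namely q_v
-- for a vertex v; returns 0 at 0)
inv : ℚ → ℚ
inv q with q ℚP.≟ 0ℚ
... | yes _ = 0ℚ
... | no  q≢0 = ℚ.1/_ q {{ℚ.≢-nonZero q≢0}}

ratioPart : ∀ {n} → LaurentPoly n → Exp n → QPoly n
ratioPart Q v =
  map (λ { (k , c) → (k -ₑ v , ℚ.- (toℚ c ℚ.* inv (toℚ (coeff Q v)))) })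
      (filter (λ kc → ¬? (proj₁ kc ≟ₑ v)) Q)

partialExpansion : ∀ {n} → LaurentPoly n → LaurentPoly n → Exp n → ℕ → QPoly n
partialExpansion P Q v M =
  mulQ (map (λ { (k , c) → (k -ₑ v , toℚ c ℚ.* inv (toℚ (coeff Q v))) }) P)
       (geomQ (ratioPart Q v) M)

-- ExpCoeff P Q v k c : the coefficient of x^k in the Laurent series
-- expansion of P/Q with respect to v is c (the formal sum over m is
-- well defined, i.e. the coefficient of x^k of the partial sums
-- stabilises, and its eventual value is c).
ExpCoeff : ∀ {n} → LaurentPoly n → LaurentPoly n → Exp n → Exp n → ℚ → Set
ExpCoeff P Q v k c =
  ∃[ M₀ ] (∀ M → M₀ ℕ.≤ M → coeffℚ (partialExpansion P Q v M) k ≡ c)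

pIntegral : ℕ → ℚ → Set
pIntegral p c = ¬ (p ℕDiv.∣ ↧ₙ c)

-- a ≡ b (mod p^r) in ℤ_p  (for a, b ∈ ℤ_p)
CongPow : ℕ → ℕ → ℚ → ℚ → Set
CongPow p r a b = (+ (p ℕ.^ r)) ℤDiv.∣ (↥ (a ℚ.- b))

-- a formal Laurent series, given by its coefficient relation F k c
-- ("the coefficient of x^k is c"), satisfies the Gauss congruences for p
GaussCongruences : ∀ {n} → (Exp n → ℚ → Set) → ℕ → Set
GaussCongruences F p =
  (∀ k c → F k c → pIntegral p c) ×
  (∀ m r a b → 1 ℕ.≤ r →
     F ((p ℕ.^ r) ·ₑ m) a → F ((p ℕ.^ (r ℕ.∸ 1)) ·ₑ m) b → CongPow p r a b)

GaussProperty : ∀ {n} → (Exp n → ℚ → Set) → Set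
GaussProperty F = ∃[ B ] (∀ p → Prime p → B ℕ.< p → GaussCongruences F p)

RatGauss : ∀ {n} → LaurentPoly n → LaurentPoly n → Set
RatGauss P Q = ∀ v → IsVertex Q v → GaussProperty (ExpCoeff P Q v)

NewtonSubset : ∀ {n} → LaurentPoly n → LaurentPoly n → Set
NewtonSubset P Q = ∀ x → InNewton P x → InNewton Q x

-- If some a ∈ supp P lay outside N(Q), Gordan's alternative (proved by Fourier–Motzkin
-- elimination) would give a linear form l with l·a > l·q for every q ∈ supp Q. Order exponents by
-- the key e ↦ (l·e, e) compared lexicographically, a total order compatible with addition, and let
-- v, w be the key-maximal exponents of Q and P. Then v is a vertex of N(Q), and every exponent of
-- the geometric series in the expansion of P/Q at v has negative key. Hence the coefficient of
-- x^(w−v) is p_w/q_v ≠ 0, while for s ≥ 2 the coefficient of x^(s(w−v)) vanishes since l·w > l·v.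
-- For a prime p beyond the Gauss threshold and the numerator of p_w/q_v, the congruence with
-- r = 1 says that p divides that numerator: a contradiction. So supp P ⊆ N(Q), and N(P) ⊆ N(Q)
-- by convexity.
module Submission where

open import Data.Nat using (ℕ)
open import Relation.Nullary using (¬_)
open import Defs

open import Data.Nat as ℕ using (zero; suc)
import Data.Nat.Properties as ℕP
import Data.Nat.Divisibility as ℕDiv
open import Data.Nat.Primality using (Prime; prime⇒nonTrivial)
open import Data.Nat.Primality.Factorisation using (factorise; PrimeFactorisation)
open import Data.Nat.ListAction using (product)
open import Data.Integer as ℤ using (ℤ; +_)
import Data.Integer.Properties as ℤP
import Data.Integer.Solver as ℤSolver
import Data.Rational as Q
open Q using (ℚ; 0ℚ; 1ℚ; ↥_; _+_; _*_; _-_; -_; _<_; _≤_)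
import Data.Rational.Properties as ℚP
import Data.Rational.Unnormalised as ℚᵘ
import Data.Rational.Unnormalised.Properties as ℚᵘP
open import Data.Rational.Solver using (module +-*-Solver)
open import Data.Vec as Vec using (Vec; []; _∷_)
open import Data.List as List using (List; []; _∷_; _++_)
import Data.List.Properties as ListP
open import Data.List.Relation.Unary.All as All using (All; []; _∷_)
import Data.List.Relation.Unary.All.Properties as AllP
open import Data.List.Relation.Unary.Any using (here; there)
open import Data.List.Membership.Propositional using (_∈_)
open import Data.List.Membership.Propositional.Properties using (∈-filter⁺)
open import Data.Product using (Σ; _×_; _,_; proj₁; proj₂)
open import Data.Sum using (_⊎_; inj₁; inj₂; [_,_]′)
open import Data.Empty using (⊥; ⊥-elim)
open import Data.Unit using (⊤; tt)
open import Function using (_∘_)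
open import Relation.Nullary using (yes; no; ¬?)
open import Relation.Binary.Definitions using (Tri; tri<; tri≈; tri>)
open import Relation.Binary.PropositionalEquality

open +-*-Solver

toℚᵘ-toℚ : ∀ z → Q.toℚᵘ (toℚ z) ℚᵘ.≃ ℚᵘ.mkℚᵘ z 0
toℚᵘ-toℚ z = ℚP.toℚᵘ-fromℚᵘ (ℚᵘ.mkℚᵘ z 0)

toℚ-+ : ∀ a b → toℚ (a ℤ.+ b) ≡ toℚ a + toℚ b
toℚ-+ a b = ℚP.toℚᵘ-injective (ℚᵘP.≃-trans (toℚᵘ-toℚ (a ℤ.+ b))
  (ℚᵘP.≃-trans (ℚᵘ.*≡* (cong₂ ℤ._*_ (cong₂ ℤ._+_ (sym (ℤP.*-identityʳ a)) (sym (ℤP.*-identityʳ b))) refl))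
  (ℚᵘP.≃-sym (ℚᵘP.≃-trans (ℚP.toℚᵘ-homo-+ (toℚ a) (toℚ b)) (ℚᵘP.+-cong (toℚᵘ-toℚ a) (toℚᵘ-toℚ b))))))

toℚ-* : ∀ a b → toℚ (a ℤ.* b) ≡ toℚ a * toℚ b
toℚ-* a b = ℚP.toℚᵘ-injective (ℚᵘP.≃-trans (toℚᵘ-toℚ (a ℤ.* b))
  (ℚᵘP.≃-sym (ℚᵘP.≃-trans (ℚP.toℚᵘ-homo-* (toℚ a) (toℚ b)) (ℚᵘP.*-cong (toℚᵘ-toℚ a) (toℚᵘ-toℚ b)))))

toℚ-neg : ∀ a → toℚ (ℤ.- a) ≡ - toℚ a
toℚ-neg a = ℚP.toℚᵘ-injective (ℚᵘP.≃-trans (toℚᵘ-toℚ (ℤ.- a))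
  (ℚᵘP.≃-sym (ℚᵘP.≃-trans (ℚP.toℚᵘ-homo‿- (toℚ a)) (ℚᵘP.-‿cong (toℚᵘ-toℚ a)))))

toℚ-- : ∀ a b → toℚ (a ℤ.- b) ≡ toℚ a - toℚ b
toℚ-- a b = trans (toℚ-+ a (ℤ.- b)) (cong (λ x → toℚ a + x) (toℚ-neg b))

toℚ-injective : ∀ {a b} → toℚ a ≡ toℚ b → a ≡ b
toℚ-injective {a} {b} eq with ℚᵘP.≃-trans (ℚᵘP.≃-sym (toℚᵘ-toℚ a)) (ℚᵘP.≃-trans (ℚP.toℚᵘ-cong eq) (toℚᵘ-toℚ b))
... | ℚᵘ.*≡* a*1≡b*1 = trans (sym (ℤP.*-identityʳ a)) (trans a*1≡b*1 (ℤP.*-identityʳ b))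

toℚ≢0 : ∀ {c} → c ≢ + 0 → toℚ c ≢ 0ℚ
toℚ≢0 c≢0 eq = c≢0 (toℚ-injective eq)

0<1 : 0ℚ < 1ℚ
0<1 = Q.*<* (ℤ.+<+ (ℕ.s≤s ℕ.z≤n))

0≤1 : 0ℚ ≤ 1ℚ
0≤1 = ℚP.<⇒≤ 0<1

*-pos : ∀ {a b} → 0ℚ < a → 0ℚ < b → 0ℚ < a * b
*-pos {a} {b} 0<a 0<b = ℚP.positive⁻¹ (a * b) {{ℚP.pos*pos⇒pos a {{Q.positive 0<a}} b {{Q.positive 0<b}}}}

*-nonNeg : ∀ {a b} → 0ℚ ≤ a → 0ℚ ≤ b → 0ℚ ≤ a * b
*-nonNeg {a} {b} 0≤a 0≤b = subst (_≤ a * b) (ℚP.*-zeroʳ a) (ℚP.*-monoˡ-≤-nonNeg a {{Q.nonNegative 0≤a}} 0≤b)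

*-cancelʳ-pos : ∀ {c x} → 0ℚ < c → 0ℚ < x * c → 0ℚ < x
*-cancelʳ-pos {c} {x} 0<c 0<xc =
  ℚP.*-cancelʳ-<-nonNeg c {{Q.nonNegative (ℚP.<⇒≤ 0<c)}} (subst (_< x * c) (sym (ℚP.*-zeroˡ c)) 0<xc)

<⇒0<- : ∀ {a b} → a < b → 0ℚ < b - a
<⇒0<- {a} {b} a<b = subst (_< b - a) (ℚP.+-inverseʳ a) (ℚP.+-monoˡ-< (- a) a<b)

0<-⇒< : ∀ {a b} → 0ℚ < b - a → a < b
0<-⇒< {a} {b} 0<b-a =
  subst₂ _<_ (ℚP.+-identityˡ a) (solve 2 (λ a b → (b :- a) :+ a := b) refl a b) (ℚP.+-monoˡ-< a 0<b-a)

0<⇒≢0 : ∀ {a} → 0ℚ < a → a ≢ 0ℚ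
0<⇒≢0 0<a a≡0 = ℚP.<-irrefl (sym a≡0) 0<a

<0⇒≢0 : ∀ {a} → a < 0ℚ → a ≢ 0ℚ
<0⇒≢0 a<0 a≡0 = ℚP.<-irrefl a≡0 a<0

inv-inverseˡ : ∀ q → q ≢ 0ℚ → inv q * q ≡ 1ℚ
inv-inverseˡ q q≢0 with q ℚP.≟ 0ℚ
... | yes q≡0 = ⊥-elim (q≢0 q≡0)
... | no  q≢0 = ℚP.*-inverseˡ q {{Q.≢-nonZero q≢0}}

inv-cancelʳ : ∀ x q → q ≢ 0ℚ → (x * inv q) * q ≡ x
inv-cancelʳ x q q≢0 = trans (ℚP.*-assoc x (inv q) q) (trans (cong (x *_) (inv-inverseˡ q q≢0)) (ℚP.*-identityʳ x))

inv-pos : ∀ q → 0ℚ < q → 0ℚ < inv q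
inv-pos q 0<q with q ℚP.≟ 0ℚ
... | yes q≡0 = ⊥-elim (0<⇒≢0 0<q q≡0)
... | no  _   = ℚP.positive⁻¹ _ {{ℚP.1/pos⇒pos q {{Q.positive 0<q}}}}

inv-≢0 : ∀ q → q ≢ 0ℚ → inv q ≢ 0ℚ
inv-≢0 q q≢0 inv≡0 = 0<⇒≢0 0<1 (trans (sym (inv-inverseˡ q q≢0)) (trans (cong (_* q) inv≡0) (ℚP.*-zeroˡ q)))

*-≢0 : ∀ {a b} → a ≢ 0ℚ → b ≢ 0ℚ → a * b ≢ 0ℚ
*-≢0 {a} {b} a≢0 b≢0 ab≡0 = b≢0 (begin
  b                 ≡⟨ solve 1 (λ b → b := con 1ℚ :* b) refl b ⟩
  1ℚ * b            ≡⟨ cong (_* b) (sym (inv-inverseˡ a a≢0)) ⟩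
  (inv a * a) * b   ≡⟨ ℚP.*-assoc (inv a) a b ⟩
  inv a * (a * b)   ≡⟨ cong (inv a *_) ab≡0 ⟩
  inv a * 0ℚ        ≡⟨ ℚP.*-zeroʳ (inv a) ⟩
  0ℚ                ∎)
  where open ≡-Reasoning

*-≢0-inv : ∀ {a b} → a * b ≢ 0ℚ → a ≢ 0ℚ × b ≢ 0ℚ
*-≢0-inv {a} {b} ab≢0 =
  (λ a≡0 → ab≢0 (trans (cong (_* b) a≡0) (ℚP.*-zeroˡ b))) ,
  (λ b≡0 → ab≢0 (trans (cong (a *_) b≡0) (ℚP.*-zeroʳ a)))

infixl 6 _-ᵛ_

0ᵛ : ∀ {m} → Vec ℚ m
0ᵛ {m} = Vec.replicate m 0ℚ

_-ᵛ_ : ∀ {m} → Vec ℚ m → Vec ℚ m → Vec ℚ m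
[] -ᵛ [] = []
(a ∷ x) -ᵛ (b ∷ y) = (a - b) ∷ (x -ᵛ y)

dot : ∀ {m} → Vec ℚ m → Vec ℚ m → ℚ
dot [] [] = 0ℚ
dot (a ∷ x) (b ∷ y) = a * b + dot x y

+ᵛ-identityʳ : ∀ {m} (x : Vec ℚ m) → x +ᵛ 0ᵛ ≡ x
+ᵛ-identityʳ [] = refl
+ᵛ-identityʳ (a ∷ x) = cong₂ _∷_ (ℚP.+-identityʳ a) (+ᵛ-identityʳ x)

+ᵛ-identityˡ : ∀ {m} (x : Vec ℚ m) → 0ᵛ +ᵛ x ≡ x
+ᵛ-identityˡ [] = refl
+ᵛ-identityˡ (a ∷ x) = cong₂ _∷_ (ℚP.+-identityˡ a) (+ᵛ-identityˡ x)

+ᵛ-comm : ∀ {m} (x y : Vec ℚ m) → x +ᵛ y ≡ y +ᵛ x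
+ᵛ-comm [] [] = refl
+ᵛ-comm (a ∷ x) (b ∷ y) = cong₂ _∷_ (ℚP.+-comm a b) (+ᵛ-comm x y)

+ᵛ-assoc : ∀ {m} (x y z : Vec ℚ m) → (x +ᵛ y) +ᵛ z ≡ x +ᵛ (y +ᵛ z)
+ᵛ-assoc [] [] [] = refl
+ᵛ-assoc (a ∷ x) (b ∷ y) (c ∷ z) = cong₂ _∷_ (ℚP.+-assoc a b c) (+ᵛ-assoc x y z)

·ᵛ-distribˡ-+ᵛ : ∀ {m} c (x y : Vec ℚ m) → c ·ᵛ (x +ᵛ y) ≡ (c ·ᵛ x) +ᵛ (c ·ᵛ y)
·ᵛ-distribˡ-+ᵛ c [] [] = refl
·ᵛ-distribˡ-+ᵛ c (a ∷ x) (b ∷ y) = cong₂ _∷_ (ℚP.*-distribˡ-+ c a b) (·ᵛ-distribˡ-+ᵛ c x y)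

·ᵛ-distribʳ-+ : ∀ {m} c d (x : Vec ℚ m) → (c + d) ·ᵛ x ≡ (c ·ᵛ x) +ᵛ (d ·ᵛ x)
·ᵛ-distribʳ-+ c d [] = refl
·ᵛ-distribʳ-+ c d (a ∷ x) = cong₂ _∷_ (ℚP.*-distribʳ-+ a c d) (·ᵛ-distribʳ-+ c d x)

·ᵛ-assoc : ∀ {m} c d (x : Vec ℚ m) → c ·ᵛ (d ·ᵛ x) ≡ (c * d) ·ᵛ x
·ᵛ-assoc c d [] = refl
·ᵛ-assoc c d (a ∷ x) = cong₂ _∷_ (sym (ℚP.*-assoc c d a)) (·ᵛ-assoc c d x)

·ᵛ-identityˡ : ∀ {m} (x : Vec ℚ m) → 1ℚ ·ᵛ x ≡ x
·ᵛ-identityˡ [] = refl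
·ᵛ-identityˡ (a ∷ x) = cong₂ _∷_ (ℚP.*-identityˡ a) (·ᵛ-identityˡ x)

·ᵛ-zeroˡ : ∀ {m} (x : Vec ℚ m) → 0ℚ ·ᵛ x ≡ 0ᵛ
·ᵛ-zeroˡ [] = refl
·ᵛ-zeroˡ (a ∷ x) = cong₂ _∷_ (ℚP.*-zeroˡ a) (·ᵛ-zeroˡ x)

·ᵛ-zeroʳ : ∀ {m} c → c ·ᵛ 0ᵛ {m} ≡ 0ᵛ
·ᵛ-zeroʳ {zero} c = refl
·ᵛ-zeroʳ {suc m} c = cong₂ _∷_ (ℚP.*-zeroʳ c) (·ᵛ-zeroʳ {m} c)

-ᵛ-inverse : ∀ {m} (x : Vec ℚ m) → x -ᵛ x ≡ 0ᵛ
-ᵛ-inverse [] = refl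
-ᵛ-inverse (a ∷ x) = cong₂ _∷_ (ℚP.+-inverseʳ a) (-ᵛ-inverse x)

[x-y]+y≡x : ∀ {m} (x y : Vec ℚ m) → (x -ᵛ y) +ᵛ y ≡ x
[x-y]+y≡x [] [] = refl
[x-y]+y≡x (a ∷ x) (b ∷ y) = cong₂ _∷_ (solve 2 (λ a b → (a :- b) :+ b := a) refl a b) ([x-y]+y≡x x y)

x-y≡0⇒x≡y : ∀ {m} {x y : Vec ℚ m} → x -ᵛ y ≡ 0ᵛ → x ≡ y
x-y≡0⇒x≡y {x = x} {y} eq = trans (sym ([x-y]+y≡x x y)) (trans (cong (_+ᵛ y) eq) (+ᵛ-identityˡ y))

[z-y]+[y-x]≡z-x : ∀ {m} (x y z : Vec ℚ m) → (z -ᵛ y) +ᵛ (y -ᵛ x) ≡ z -ᵛ x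
[z-y]+[y-x]≡z-x [] [] [] = refl
[z-y]+[y-x]≡z-x (a ∷ x) (b ∷ y) (c ∷ z) =
  cong₂ _∷_ (solve 3 (λ a b c → (c :- b) :+ (b :- a) := c :- a) refl a b c) ([z-y]+[y-x]≡z-x x y z)

0-[y-x]≡x-y : ∀ {m} (x y : Vec ℚ m) → 0ᵛ -ᵛ (y -ᵛ x) ≡ x -ᵛ y
0-[y-x]≡x-y [] [] = refl
0-[y-x]≡x-y (a ∷ x) (b ∷ y) = cong₂ _∷_ (solve 2 (λ a b → con 0ℚ :- (b :- a) := a :- b) refl a b) (0-[y-x]≡x-y x y)

[y₁+y₂]-[x₁+x₂]≡[y₁-x₁]+[y₂-x₂] : ∀ {m} (x₁ x₂ y₁ y₂ : Vec ℚ m) →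
  (y₁ +ᵛ y₂) -ᵛ (x₁ +ᵛ x₂) ≡ (y₁ -ᵛ x₁) +ᵛ (y₂ -ᵛ x₂)
[y₁+y₂]-[x₁+x₂]≡[y₁-x₁]+[y₂-x₂] [] [] [] [] = refl
[y₁+y₂]-[x₁+x₂]≡[y₁-x₁]+[y₂-x₂] (a ∷ x₁) (b ∷ x₂) (c ∷ y₁) (d ∷ y₂) =
  cong₂ _∷_ (solve 4 (λ a b c d → (c :+ d) :- (a :+ b) := (c :- a) :+ (d :- b)) refl a b c d)
            ([y₁+y₂]-[x₁+x₂]≡[y₁-x₁]+[y₂-x₂] x₁ x₂ y₁ y₂)

cy-cx≡c[y-x] : ∀ {m} c (x y : Vec ℚ m) → (c ·ᵛ y) -ᵛ (c ·ᵛ x) ≡ c ·ᵛ (y -ᵛ x)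
cy-cx≡c[y-x] c [] [] = refl
cy-cx≡c[y-x] c (a ∷ x) (b ∷ y) =
  cong₂ _∷_ (solve 3 (λ c a b → c :* b :- c :* a := c :* (b :- a)) refl c a b) (cy-cx≡c[y-x] c x y)

tx+[1-t]x≡x : ∀ {m} t (x : Vec ℚ m) → (t ·ᵛ x) +ᵛ ((1ℚ - t) ·ᵛ x) ≡ x
tx+[1-t]x≡x t [] = refl
tx+[1-t]x≡x t (a ∷ x) =
  cong₂ _∷_ (solve 2 (λ t a → t :* a :+ (con 1ℚ :- t) :* a := a) refl t a) (tx+[1-t]x≡x t x)

dot-+ᵛ : ∀ {m} (l x y : Vec ℚ m) → dot l (x +ᵛ y) ≡ dot l x + dot l y
dot-+ᵛ [] [] [] = refl
dot-+ᵛ (c ∷ l) (a ∷ x) (b ∷ y) rewrite dot-+ᵛ l x y =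
  solve 5 (λ c a b u v → c :* (a :+ b) :+ (u :+ v) := (c :* a :+ u) :+ (c :* b :+ v))
          refl c a b (dot l x) (dot l y)

dot-·ᵛ : ∀ {m} (l : Vec ℚ m) c x → dot l (c ·ᵛ x) ≡ c * dot l x
dot-·ᵛ [] c [] = sym (ℚP.*-zeroʳ c)
dot-·ᵛ (d ∷ l) c (a ∷ x) rewrite dot-·ᵛ l c x =
  solve 4 (λ d c a u → d :* (c :* a) :+ c :* u := c :* (d :* a :+ u)) refl d c a (dot l x)

dot-0ᵛ : ∀ {m} (l : Vec ℚ m) → dot l 0ᵛ ≡ 0ℚ
dot-0ᵛ [] = refl
dot-0ᵛ (d ∷ l) rewrite dot-0ᵛ l = solve 1 (λ d → d :* con 0ℚ :+ con 0ℚ := con 0ℚ) refl d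

dot--ᵛ : ∀ {m} (l x y : Vec ℚ m) → dot l (x -ᵛ y) ≡ dot l x - dot l y
dot--ᵛ [] [] [] = refl
dot--ᵛ (c ∷ l) (a ∷ x) (b ∷ y) rewrite dot--ᵛ l x y =
  solve 5 (λ c a b u v → c :* (a :- b) :+ (u :- v) := (c :* a :+ u) :- (c :* b :+ v))
          refl c a b (dot l x) (dot l y)

-- The lexicographic order on ℚᵐ

Pos : ∀ {m} → Vec ℚ m → Set
Pos [] = ⊥
Pos (a ∷ x) = (0ℚ < a) ⊎ (a ≡ 0ℚ × Pos x)

NonNeg : ∀ {m} → Vec ℚ m → Set
NonNeg x = Pos x ⊎ x ≡ 0ᵛ

infix 4 _≤ₗ_ _<ₗ_

_≤ₗ_ : ∀ {m} → Vec ℚ m → Vec ℚ m → Set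
x ≤ₗ y = NonNeg (y -ᵛ x)

_<ₗ_ : ∀ {m} → Vec ℚ m → Vec ℚ m → Set
x <ₗ y = Pos (y -ᵛ x)

Pos-+ᵛ : ∀ {m} {x y : Vec ℚ m} → Pos x → Pos y → Pos (x +ᵛ y)
Pos-+ᵛ {x = a ∷ x} {b ∷ y} (inj₁ 0<a) (inj₁ 0<b) = inj₁ (ℚP.+-mono-< 0<a 0<b)
Pos-+ᵛ {x = a ∷ x} {b ∷ y} (inj₁ 0<a) (inj₂ (refl , _)) = inj₁ (subst (0ℚ <_) (sym (ℚP.+-identityʳ a)) 0<a)
Pos-+ᵛ {x = a ∷ x} {b ∷ y} (inj₂ (refl , _)) (inj₁ 0<b) = inj₁ (subst (0ℚ <_) (sym (ℚP.+-identityˡ b)) 0<b)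
Pos-+ᵛ {x = a ∷ x} {b ∷ y} (inj₂ (refl , px)) (inj₂ (refl , py)) = inj₂ (refl , Pos-+ᵛ px py)

Pos-+ᵛ-NonNeg : ∀ {m} {x y : Vec ℚ m} → Pos x → NonNeg y → Pos (x +ᵛ y)
Pos-+ᵛ-NonNeg px (inj₁ py) = Pos-+ᵛ px py
Pos-+ᵛ-NonNeg {x = x} px (inj₂ refl) = subst Pos (sym (+ᵛ-identityʳ x)) px

NonNeg-+ᵛ : ∀ {m} {x y : Vec ℚ m} → NonNeg x → NonNeg y → NonNeg (x +ᵛ y)
NonNeg-+ᵛ (inj₁ px) ny = inj₁ (Pos-+ᵛ-NonNeg px ny)
NonNeg-+ᵛ {y = y} (inj₂ refl) ny = subst NonNeg (sym (+ᵛ-identityˡ y)) ny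

Pos-·ᵛ : ∀ {m} {c} {x : Vec ℚ m} → 0ℚ < c → Pos x → Pos (c ·ᵛ x)
Pos-·ᵛ {x = a ∷ x} 0<c (inj₁ 0<a) = inj₁ (*-pos 0<c 0<a)
Pos-·ᵛ {c = c} {x = a ∷ x} 0<c (inj₂ (refl , px)) = inj₂ (ℚP.*-zeroʳ c , Pos-·ᵛ 0<c px)

NonNeg-·ᵛ : ∀ {m} {c} {x : Vec ℚ m} → 0ℚ ≤ c → NonNeg x → NonNeg (c ·ᵛ x)
NonNeg-·ᵛ {c = c} {x} 0≤c nx with ℚP.<-cmp 0ℚ c
... | tri< 0<c _ _ = [ (λ px → inj₁ (Pos-·ᵛ 0<c px)) , (λ x≡0 → inj₂ (trans (cong (c ·ᵛ_) x≡0) (·ᵛ-zeroʳ c))) ]′ nx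
... | tri≈ _ refl _ = inj₂ (·ᵛ-zeroˡ x)
... | tri> _ _ c<0 = ⊥-elim (ℚP.<-irrefl refl (ℚP.<-≤-trans c<0 0≤c))

¬Pos-0ᵛ : ∀ {m} → ¬ Pos (0ᵛ {m})
¬Pos-0ᵛ {suc m} (inj₁ 0<0) = ℚP.<-irrefl refl 0<0
¬Pos-0ᵛ {suc m} (inj₂ (_ , p)) = ¬Pos-0ᵛ {m} p

NonNeg-head : ∀ {m} {a} {x : Vec ℚ m} → NonNeg (a ∷ x) → 0ℚ ≤ a
NonNeg-head (inj₁ (inj₁ 0<a)) = ℚP.<⇒≤ 0<a
NonNeg-head (inj₁ (inj₂ (refl , _))) = ℚP.≤-refl
NonNeg-head (inj₂ eq) = ℚP.≤-reflexive (sym (cong Vec.head eq))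

Pos-trichotomy : ∀ {m} (x : Vec ℚ m) → Pos x ⊎ x ≡ 0ᵛ ⊎ Pos (0ᵛ -ᵛ x)
Pos-trichotomy [] = inj₂ (inj₁ refl)
Pos-trichotomy (a ∷ x) with ℚP.<-cmp 0ℚ a
... | tri< 0<a _ _ = inj₁ (inj₁ 0<a)
... | tri> _ _ a<0 = inj₂ (inj₂ (inj₁ (subst (0ℚ <_) (sym (ℚP.+-identityˡ (- a))) (ℚP.neg-antimono-< a<0))))
... | tri≈ _ refl _ with Pos-trichotomy x
...   | inj₁ p = inj₁ (inj₂ (refl , p))
...   | inj₂ (inj₁ x≡0) = inj₂ (inj₁ (cong (0ℚ ∷_) x≡0))
...   | inj₂ (inj₂ p) = inj₂ (inj₂ (inj₂ (refl , p)))

≤ₗ-refl : ∀ {m} (x : Vec ℚ m) → x ≤ₗ x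
≤ₗ-refl x = inj₂ (-ᵛ-inverse x)

≤ₗ-reflexive : ∀ {m} {x y : Vec ℚ m} → x ≡ y → x ≤ₗ y
≤ₗ-reflexive {x = x} refl = ≤ₗ-refl x

<ₗ-irrefl : ∀ {m} (x : Vec ℚ m) → ¬ (x <ₗ x)
<ₗ-irrefl x x<x = ¬Pos-0ᵛ (subst Pos (-ᵛ-inverse x) x<x)

≤ₗ-trans : ∀ {m} {x y z : Vec ℚ m} → x ≤ₗ y → y ≤ₗ z → x ≤ₗ z
≤ₗ-trans {x = x} {y} {z} x≤y y≤z = subst NonNeg ([z-y]+[y-x]≡z-x x y z) (NonNeg-+ᵛ y≤z x≤y)

≤ₗ-total : ∀ {m} (x y : Vec ℚ m) → x ≤ₗ y ⊎ y ≤ₗ x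
≤ₗ-total x y with Pos-trichotomy (y -ᵛ x)
... | inj₁ x<y = inj₁ (inj₁ x<y)
... | inj₂ (inj₁ y-x≡0) = inj₁ (inj₂ y-x≡0)
... | inj₂ (inj₂ 0<x-y) = inj₂ (inj₁ (subst Pos (0-[y-x]≡x-y x y) 0<x-y))

+ᵛ-mono-<-≤ₗ : ∀ {m} {x₁ x₂ y₁ y₂ : Vec ℚ m} → x₁ <ₗ y₁ → x₂ ≤ₗ y₂ → x₁ +ᵛ x₂ <ₗ y₁ +ᵛ y₂
+ᵛ-mono-<-≤ₗ {x₁ = x₁} {x₂} {y₁} {y₂} x₁<y₁ x₂≤y₂ =
  subst Pos (sym ([y₁+y₂]-[x₁+x₂]≡[y₁-x₁]+[y₂-x₂] x₁ x₂ y₁ y₂)) (Pos-+ᵛ-NonNeg x₁<y₁ x₂≤y₂)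

+ᵛ-mono-≤-<ₗ : ∀ {m} {x₁ x₂ y₁ y₂ : Vec ℚ m} → x₁ ≤ₗ y₁ → x₂ <ₗ y₂ → x₁ +ᵛ x₂ <ₗ y₁ +ᵛ y₂
+ᵛ-mono-≤-<ₗ {x₁ = x₁} {x₂} {y₁} {y₂} x₁≤y₁ x₂<y₂ =
  subst₂ _<ₗ_ (+ᵛ-comm x₂ x₁) (+ᵛ-comm y₂ y₁) (+ᵛ-mono-<-≤ₗ x₂<y₂ x₁≤y₁)

·ᵛ-mono-<ₗ : ∀ {m} {c} {x y : Vec ℚ m} → 0ℚ < c → x <ₗ y → c ·ᵛ x <ₗ c ·ᵛ y
·ᵛ-mono-<ₗ {c = c} {x} {y} 0<c x<y = subst Pos (sym (cy-cx≡c[y-x] c x y)) (Pos-·ᵛ 0<c x<y)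

·ᵛ-mono-≤ₗ : ∀ {m} {c} {x y : Vec ℚ m} → 0ℚ ≤ c → x ≤ₗ y → c ·ᵛ x ≤ₗ c ·ᵛ y
·ᵛ-mono-≤ₗ {c = c} {x} {y} 0≤c x≤y = subst NonNeg (sym (cy-cx≡c[y-x] c x y)) (NonNeg-·ᵛ 0≤c x≤y)

-- Gordan's alternative

module _ {A B : Set} (_≼_ : B → B → Set) (≼-total : ∀ a b → a ≼ b ⊎ b ≼ a)
         (≼-refl : ∀ a → a ≼ a) (≼-trans : ∀ {a b c} → a ≼ b → b ≼ c → a ≼ c) (f : A → B) where

  argmax : (x : A) (xs : List A) → Σ A λ y → y ∈ x ∷ xs × All (λ z → f z ≼ f y) (x ∷ xs)
  argmax x [] = x , here refl , ≼-refl (f x) ∷ []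
  argmax x (y ∷ ys) with argmax y ys
  ... | z , z∈ , z-max with ≼-total (f x) (f z)
  ...   | inj₁ x≼z = z , there z∈ , x≼z ∷ z-max
  ...   | inj₂ z≼x = x , here refl , ≼-refl (f x) ∷ All.map (λ w≼z → ≼-trans w≼z z≼x) z-max

argmaxℚ : ∀ {A : Set} (f : A → ℚ) x xs → Σ A λ y → y ∈ x ∷ xs × All (λ z → f z ≤ f y) (x ∷ xs)
argmaxℚ = argmax _≤_ ℚP.≤-total (λ _ → ℚP.≤-refl) ℚP.≤-trans

argminℚ : ∀ {A : Set} (f : A → ℚ) x xs → Σ A λ y → y ∈ x ∷ xs × All (λ z → f y ≤ f z) (x ∷ xs)
argminℚ = argmax (λ a b → b ≤ a) (λ a b → ℚP.≤-total b a) (λ _ → ℚP.≤-refl) (λ p q → ℚP.≤-trans q p)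

separate : ∀ {A B : Set} (f : A → ℚ) (g : B → ℚ) (xs : List A) (ys : List B) →
  All (λ x → All (λ y → f x < g y) ys) xs →
  Σ ℚ λ c → All (λ x → f x < c) xs × All (λ y → c < g y) ys
separate f g [] [] _ = 0ℚ , [] , []
separate f g [] (y ∷ ys) _ with argminℚ g y ys
... | y₀ , _ , y₀-min = g y₀ - 1ℚ , [] , All.map (ℚP.<-≤-trans (0<-⇒< (subst (0ℚ <_) (1≡a-[a-1] (g y₀)) 0<1))) y₀-min
  where
  1≡a-[a-1] : ∀ a → 1ℚ ≡ a - (a - 1ℚ)
  1≡a-[a-1] = solve 1 (λ a → con 1ℚ := a :- (a :- con 1ℚ)) refl
separate f g (x ∷ xs) [] _ with argmaxℚ f x xs
... | x₀ , _ , x₀-max = f x₀ + 1ℚ , All.map (λ fx≤ → ℚP.≤-<-trans fx≤ (0<-⇒< (subst (0ℚ <_) (1≡[a+1]-a (f x₀)) 0<1))) x₀-max , []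
  where
  1≡[a+1]-a : ∀ a → 1ℚ ≡ (a + 1ℚ) - a
  1≡[a+1]-a = solve 1 (λ a → con 1ℚ := (a :+ con 1ℚ) :- a) refl
separate f g (x ∷ xs) (y ∷ ys) f<g
  with argmaxℚ f x xs
     | argminℚ g y ys
... | x₀ , x₀∈ , x₀-max | y₀ , y₀∈ , y₀-min =
  c , All.map (λ fx≤ → ℚP.≤-<-trans fx≤ fx₀<c) x₀-max , All.map (ℚP.<-≤-trans c<gy₀) y₀-min
  where
  fx₀<gy₀ : f x₀ < g y₀
  fx₀<gy₀ = All.lookup (All.lookup f<g x₀∈) y₀∈
  c = (f x₀ + g y₀) * Q.½
  ½[b-a] : 0ℚ < (g y₀ - f x₀) * Q.½
  ½[b-a] = *-pos (<⇒0<- fx₀<gy₀) (Q.*<* (ℤ.+<+ (ℕ.s≤s ℕ.z≤n)))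
  fx₀<c : f x₀ < c
  fx₀<c = 0<-⇒< (subst (0ℚ <_) (solve 2 (λ a b → (b :- a) :* con Q.½ := (a :+ b) :* con Q.½ :- a) refl (f x₀) (g y₀)) ½[b-a])
  c<gy₀ : c < g y₀
  c<gy₀ = 0<-⇒< (subst (0ℚ <_) (solve 2 (λ a b → (b :- a) :* con Q.½ := b :- (a :+ b) :* con Q.½) refl (f x₀) (g y₀)) ½[b-a])

vsum : ∀ {I : Set} {m} → (I → Vec ℚ m) → List (I × ℚ) → Vec ℚ m
vsum u [] = 0ᵛ
vsum u ((i , y) ∷ ws) = (y ·ᵛ u i) +ᵛ vsum u ws

wsum : ∀ {I : Set} → List (I × ℚ) → ℚ
wsum [] = 0ℚ
wsum ((i , y) ∷ ws) = y + wsum ws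

vsum-++ : ∀ {I : Set} {m} (u : I → Vec ℚ m) xs ys → vsum u (xs ++ ys) ≡ vsum u xs +ᵛ vsum u ys
vsum-++ u [] ys = sym (+ᵛ-identityˡ _)
vsum-++ u ((i , y) ∷ xs) ys rewrite vsum-++ u xs ys = sym (+ᵛ-assoc _ _ _)

wsum-++ : ∀ {I : Set} (xs ys : List (I × ℚ)) → wsum (xs ++ ys) ≡ wsum xs + wsum ys
wsum-++ [] ys = sym (ℚP.+-identityˡ _)
wsum-++ ((i , y) ∷ xs) ys rewrite wsum-++ xs ys = sym (ℚP.+-assoc y _ _)

Gordan : (m : ℕ) {I : Set} (G : I → Set) (u : I → Vec ℚ m) (ds : List I) → Set
Gordan m {I} G u ds =
  (Σ (Vec ℚ m) λ l → All (λ i → 0ℚ < dot l (u i)) ds) ⊎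
  (Σ (List (I × ℚ)) λ ws → All (λ iy → G (proj₁ iy) × 0ℚ ≤ proj₂ iy) ws × 0ℚ < wsum ws × vsum u ws ≡ 0ᵛ)

module FourierMotzkin {I : Set} {m : ℕ} (G : I → Set) (u : I → Vec ℚ (suc m)) where

  α : I → ℚ
  α i = Vec.head (u i)

  τ : I → Vec ℚ m
  τ i = Vec.tail (u i)

  I₀ I₊ I₋ : Set
  I₀ = Σ I λ i → G i × α i ≡ 0ℚ
  I₊ = Σ I λ i → G i × 0ℚ < α i
  I₋ = Σ I λ i → G i × α i < 0ℚ

  data Derived : Set where
    keep    : I₀ → Derived
    combine : I₊ → I₋ → Derived

  derived : Derived → Vec ℚ m
  derived (keep (i , _)) = τ i
  derived (combine (i , _) (j , _)) = (α i ·ᵛ τ j) -ᵛ (α j ·ᵛ τ i)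

  Partition : Set
  Partition = List I₀ × List I₊ × List I₋

  insert : (i : I) → G i → Tri (0ℚ < α i) (0ℚ ≡ α i) (α i < 0ℚ) → Partition → Partition
  insert i g (tri< 0<α _ _) (Z , P , N) = Z , (i , g , 0<α) ∷ P , N
  insert i g (tri≈ _ 0≡α _) (Z , P , N) = (i , g , sym 0≡α) ∷ Z , P , N
  insert i g (tri> _ _ α<0) (Z , P , N) = Z , P , (i , g , α<0) ∷ N

  partition : (ds : List I) → All G ds → Partition
  partition [] [] = [] , [] , []
  partition (i ∷ ds) (g ∷ gs) = insert i g (ℚP.<-cmp 0ℚ (α i)) (partition ds gs)

  AllParts : (I → Set) → Partition → Set
  AllParts R (Z , P , N) = All (R ∘ proj₁) Z × All (R ∘ proj₁) P × All (R ∘ proj₁) N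

  AllParts-insert : ∀ (R : I → Set) (ds : List I) i g t T →
    (AllParts R T → All R ds) → AllParts R (insert i g t T) → All R (i ∷ ds)
  AllParts-insert R ds i g (tri< _ _ _) T k (rz , r ∷ rp , rn) = r ∷ k (rz , rp , rn)
  AllParts-insert R ds i g (tri≈ _ _ _) T k (r ∷ rz , rp , rn) = r ∷ k (rz , rp , rn)
  AllParts-insert R ds i g (tri> _ _ _) T k (rz , rp , r ∷ rn) = r ∷ k (rz , rp , rn)

  AllParts⇒All : ∀ (R : I → Set) ds (gs : All G ds) → AllParts R (partition ds gs) → All R ds
  AllParts⇒All R [] [] _ = []
  AllParts⇒All R (i ∷ ds) (g ∷ gs) =
    AllParts-insert R ds i g (ℚP.<-cmp 0ℚ (α i)) (partition ds gs) (AllParts⇒All R ds gs)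

  combinations : List I₊ → List I₋ → List Derived
  combinations [] N = []
  combinations (p ∷ P) N = List.map (combine p) N ++ combinations P N

  derivedList : Partition → List Derived
  derivedList (Z , P , N) = List.map keep Z ++ combinations P N

  All-combinations⁻ : ∀ (R : Derived → Set) P N → All R (combinations P N) → All (λ p → All (R ∘ combine p) N) P
  All-combinations⁻ R [] N _ = []
  All-combinations⁻ R (p ∷ P) N r with AllP.++⁻ (List.map (combine p) N) r
  ... | rp , rP = AllP.map⁻ rp ∷ All-combinations⁻ R P N rP

  lift : Derived × ℚ → List (I × ℚ)
  lift (keep (i , _) , y) = (i , y) ∷ []
  lift (combine (i , _) (j , _) , y) = (i , y * (- α j)) ∷ (j , y * α i) ∷ []

  liftAll : List (Derived × ℚ) → List (I × ℚ)
  liftAll [] = []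
  liftAll (x ∷ xs) = lift x ++ liftAll xs

  NonNegWeights : List (Derived × ℚ) → Set
  NonNegWeights = All (λ dy → ⊤ × 0ℚ ≤ proj₂ dy)

  liftAll-weights : ∀ ws → NonNegWeights ws → All (λ iy → G (proj₁ iy) × 0ℚ ≤ proj₂ iy) (liftAll ws)
  liftAll-weights [] [] = []
  liftAll-weights ((keep (i , g , _) , y) ∷ ws) ((_ , 0≤y) ∷ nn) = (g , 0≤y) ∷ liftAll-weights ws nn
  liftAll-weights ((combine (i , g , 0<αi) (j , g′ , αj<0) , y) ∷ ws) ((_ , 0≤y) ∷ nn) =
    (g , *-nonNeg 0≤y (ℚP.<⇒≤ (ℚP.neg-antimono-< αj<0))) ∷ (g′ , *-nonNeg 0≤y (ℚP.<⇒≤ 0<αi)) ∷ liftAll-weights ws nn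

  wsum-lift-nonNeg : ∀ d y → 0ℚ ≤ y → 0ℚ ≤ wsum (lift (d , y))
  wsum-lift-nonNeg (keep _) y 0≤y = ℚP.+-mono-≤ 0≤y ℚP.≤-refl
  wsum-lift-nonNeg (combine (i , _ , 0<αi) (j , _ , αj<0)) y 0≤y =
    ℚP.+-mono-≤ (*-nonNeg 0≤y (ℚP.<⇒≤ (ℚP.neg-antimono-< αj<0))) (ℚP.+-mono-≤ (*-nonNeg 0≤y (ℚP.<⇒≤ 0<αi)) ℚP.≤-refl)

  wsum-lift-pos : ∀ d y → 0ℚ < y → 0ℚ < wsum (lift (d , y))
  wsum-lift-pos (keep _) y 0<y = ℚP.+-mono-<-≤ 0<y ℚP.≤-refl
  wsum-lift-pos (combine (i , _ , 0<αi) (j , _ , αj<0)) y 0<y =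
    ℚP.+-mono-<-≤ (*-pos 0<y (ℚP.neg-antimono-< αj<0)) (ℚP.+-mono-≤ (*-nonNeg (ℚP.<⇒≤ 0<y) (ℚP.<⇒≤ 0<αi)) ℚP.≤-refl)

  wsum-liftAll-nonNeg : ∀ ws → NonNegWeights ws → 0ℚ ≤ wsum (liftAll ws)
  wsum-liftAll-nonNeg [] [] = ℚP.≤-refl
  wsum-liftAll-nonNeg ((d , y) ∷ ws) ((_ , 0≤y) ∷ nn) rewrite wsum-++ (lift (d , y)) (liftAll ws) =
    ℚP.+-mono-≤ (wsum-lift-nonNeg d y 0≤y) (wsum-liftAll-nonNeg ws nn)

  wsum-liftAll-pos : ∀ ws → NonNegWeights ws → 0ℚ < wsum ws → 0ℚ < wsum (liftAll ws)
  wsum-liftAll-pos [] [] 0<0 = 0<0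
  wsum-liftAll-pos ((d , y) ∷ ws) ((_ , 0≤y) ∷ nn) 0<Σ rewrite wsum-++ (lift (d , y)) (liftAll ws)
    with ℚP.<-cmp 0ℚ y
  ... | tri< 0<y _ _ = ℚP.+-mono-<-≤ (wsum-lift-pos d y 0<y) (wsum-liftAll-nonNeg ws nn)
  ... | tri≈ _ refl _ = subst (0ℚ <_) (ℚP.+-comm (wsum (liftAll ws)) (wsum (lift (d , y))))
          (ℚP.+-mono-<-≤ (wsum-liftAll-pos ws nn (subst (0ℚ <_) (ℚP.+-identityˡ _) 0<Σ)) (wsum-lift-nonNeg d y 0≤y))
  ... | tri> _ _ y<0 = ⊥-elim (ℚP.<-irrefl refl (ℚP.<-≤-trans y<0 0≤y))

  vsum-lift : ∀ d y → vsum u (lift (d , y)) ≡ 0ℚ ∷ (y ·ᵛ derived d)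
  vsum-lift (keep (i , _ , αi≡0)) y = keep-head (u i) αi≡0
    where
    keep-head : (x : Vec ℚ (suc m)) → Vec.head x ≡ 0ℚ → (y ·ᵛ x) +ᵛ 0ᵛ ≡ 0ℚ ∷ (y ·ᵛ Vec.tail x)
    keep-head (a ∷ x) refl = cong₂ _∷_ (solve 1 (λ y → y :* con 0ℚ :+ con 0ℚ := con 0ℚ) refl y) (+ᵛ-identityʳ _)
  vsum-lift (combine (i , _) (j , _)) y = cancel-head (u i) (u j)
    where
    cancel-tail : ∀ {k} a b (s t : Vec ℚ k) →
      ((y * (- b)) ·ᵛ t) +ᵛ (((y * a) ·ᵛ s) +ᵛ 0ᵛ) ≡ y ·ᵛ ((a ·ᵛ s) -ᵛ (b ·ᵛ t))
    cancel-tail a b [] [] = refl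
    cancel-tail a b (c ∷ s) (d ∷ t) = cong₂ _∷_
      (solve 5 (λ y a b c d → (y :* (:- b)) :* d :+ ((y :* a) :* c :+ con 0ℚ) := y :* (a :* c :- b :* d)) refl y a b c d)
      (cancel-tail a b s t)
    cancel-head : (x z : Vec ℚ (suc m)) →
      ((y * (- Vec.head z)) ·ᵛ x) +ᵛ (((y * Vec.head x) ·ᵛ z) +ᵛ 0ᵛ)
        ≡ 0ℚ ∷ (y ·ᵛ ((Vec.head x ·ᵛ Vec.tail z) -ᵛ (Vec.head z ·ᵛ Vec.tail x)))
    cancel-head (a ∷ s) (b ∷ t) = cong₂ _∷_
      (solve 3 (λ y a b → (y :* (:- b)) :* a :+ ((y :* a) :* b :+ con 0ℚ) := con 0ℚ) refl y a b)
      (cancel-tail a b t s)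

  vsum-liftAll : ∀ ws → vsum u (liftAll ws) ≡ 0ℚ ∷ vsum derived ws
  vsum-liftAll [] = refl
  vsum-liftAll ((d , y) ∷ ws)
    rewrite vsum-++ u (lift (d , y)) (liftAll ws) | vsum-lift d y | vsum-liftAll ws =
    cong (_∷ ((y ·ᵛ derived d) +ᵛ vsum derived ws)) (ℚP.+-identityˡ 0ℚ)

  module Extend (l : Vec ℚ m) where

    s : I → ℚ
    s i = dot l (τ i)

    -- Bounds for the first coordinate c of the extended form c ∷ l.
    lower : I₊ → ℚ
    lower (i , _) = (- s i) * inv (α i)

    upper : I₋ → ℚ
    upper (j , _) = (- s j) * inv (α j)

    lower<upper : ∀ p q → 0ℚ < dot l (derived (combine p q)) → lower p < upper q
    lower<upper (i , _ , 0<αi) (j , _ , αj<0) 0<l·d =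
      0<-⇒< (*-cancelʳ-pos (*-pos 0<αi (ℚP.neg-antimono-< αj<0)) (subst (0ℚ <_) l·d≡ 0<l·d))
      where
      ai = α i
      aj = α j
      b = (- s i) * inv ai
      g = (- s j) * inv aj
      l·d≡ : dot l ((ai ·ᵛ τ j) -ᵛ (aj ·ᵛ τ i)) ≡ (g - b) * (ai * (- aj))
      l·d≡ = begin
        dot l ((ai ·ᵛ τ j) -ᵛ (aj ·ᵛ τ i))  ≡⟨ dot--ᵛ l _ _ ⟩
        dot l (ai ·ᵛ τ j) - dot l (aj ·ᵛ τ i)  ≡⟨ cong₂ _-_ (dot-·ᵛ l ai (τ j)) (dot-·ᵛ l aj (τ i)) ⟩
        ai * s j - aj * s i  ≡⟨ solve 4 (λ ai aj si sj → ai :* sj :- aj :* si := (:- si) :* aj :- (:- sj) :* ai) refl ai aj (s i) (s j) ⟩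
        (- s i) * aj - (- s j) * ai  ≡⟨ cong₂ (λ x z → x * aj - z * ai) (sym (inv-cancelʳ (- s i) ai (0<⇒≢0 0<αi))) (sym (inv-cancelʳ (- s j) aj (<0⇒≢0 αj<0))) ⟩
        (b * ai) * aj - (g * aj) * ai  ≡⟨ solve 4 (λ b g ai aj → (b :* ai) :* aj :- (g :* aj) :* ai := (g :- b) :* (ai :* (:- aj))) refl b g ai aj ⟩
        (g - b) * (ai * (- aj))  ∎
        where open ≡-Reasoning

    above-lower : ∀ c (p : I₊) → lower p < c → 0ℚ < c * α (proj₁ p) + s (proj₁ p)
    above-lower c (i , _ , 0<αi) lower<c = subst (0ℚ <_) eq (*-pos (<⇒0<- lower<c) 0<αi)
      where
      eq : (c - (- s i) * inv (α i)) * α i ≡ c * α i + s i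
      eq = trans (solve 3 (λ c b a → (c :- b) :* a := c :* a :- b :* a) refl c ((- s i) * inv (α i)) (α i))
             (trans (cong (λ x → c * α i - x) (inv-cancelʳ (- s i) (α i) (0<⇒≢0 0<αi)))
               (solve 3 (λ c a s → c :* a :- (:- s) := c :* a :+ s) refl c (α i) (s i)))

    below-upper : ∀ c (q : I₋) → c < upper q → 0ℚ < c * α (proj₁ q) + s (proj₁ q)
    below-upper c (j , _ , αj<0) c<upper = subst (0ℚ <_) eq (*-pos (<⇒0<- c<upper) (ℚP.neg-antimono-< αj<0))
      where
      eq : ((- s j) * inv (α j) - c) * (- α j) ≡ c * α j + s j
      eq = trans (solve 3 (λ c g a → (g :- c) :* (:- a) := c :* a :- g :* a) refl c ((- s j) * inv (α j)) (α j))
             (trans (cong (λ x → c * α j - x) (inv-cancelʳ (- s j) (α j) (<0⇒≢0 αj<0)))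
               (solve 3 (λ c a s → c :* a :- (:- s) := c :* a :+ s) refl c (α j) (s j)))

    head-zero : ∀ c (z : I₀) → 0ℚ < s (proj₁ z) → 0ℚ < c * α (proj₁ z) + s (proj₁ z)
    head-zero c (i , _ , αi≡0) 0<s rewrite αi≡0 =
      subst (0ℚ <_) (solve 2 (λ c s → s := c :* con 0ℚ :+ s) refl c (s i)) 0<s

-- Fourier–Motzkin: separate the vectors obtained by eliminating the first coordinate (or find
-- a vanishing combination of them, which lifts back), then fit the first coordinate of the form
-- between the bounds coming from vectors with positive and with negative first entry.
gordan : ∀ m {I : Set} (G : I → Set) (u : I → Vec ℚ m) (ds : List I) → All G ds → Gordan m G u ds
gordan zero G u [] [] = inj₁ ([] , [])
gordan zero G u (i ∷ ds) (g ∷ _) =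
  inj₂ ((i , 1ℚ) ∷ [] , (g , 0≤1) ∷ [] , subst (0ℚ <_) (sym (ℚP.+-identityʳ 1ℚ)) 0<1 , Vec-0 _)
  where
  Vec-0 : (x : Vec ℚ 0) → x ≡ []
  Vec-0 [] = refl
gordan (suc m) {I} G u ds gs
  with gordan m (λ _ → ⊤) (FourierMotzkin.derived G u)
              (FourierMotzkin.derivedList G u (FourierMotzkin.partition G u ds gs)) (All.universal (λ _ → tt) _)
... | inj₂ (ws , nn , 0<Σ , Σ≡0) =
  inj₂ (liftAll ws , liftAll-weights ws nn , wsum-liftAll-pos ws nn 0<Σ , trans (vsum-liftAll ws) (cong (0ℚ ∷_) Σ≡0))
  where open FourierMotzkin G u
... | inj₁ (l , l-sep) = inj₁ (c ∷ l , AllParts⇒All R ds gs (sep₀ , sep₊ , sep₋))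
  where
  open FourierMotzkin G u
  open Extend l
  Z = proj₁ (partition ds gs)
  P = proj₁ (proj₂ (partition ds gs))
  N = proj₂ (proj₂ (partition ds gs))
  split = AllP.++⁻ (List.map keep Z) l-sep
  bounds = separate lower upper P N
    (All.map (λ {p} → All.map (λ {q} → lower<upper p q)) (All-combinations⁻ _ P N (proj₂ split)))
  c = proj₁ bounds
  R : I → Set
  R i = 0ℚ < dot (c ∷ l) (u i)
  fix : ∀ i → 0ℚ < c * α i + s i → R i
  fix i = subst (0ℚ <_) (sym (dot-cons (u i)))
    where
    dot-cons : (x : Vec ℚ (suc m)) → dot (c ∷ l) x ≡ c * Vec.head x + dot l (Vec.tail x)
    dot-cons (a ∷ x) = refl
  sep₀ = All.map (λ {z} 0<s → fix (proj₁ z) (head-zero c z 0<s)) (AllP.map⁻ (proj₁ split))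
  sep₊ = All.map (λ {p} lower<c → fix (proj₁ p) (above-lower c p lower<c)) (proj₁ (proj₂ bounds))
  sep₋ = All.map (λ {q} c<upper → fix (proj₁ q) (below-upper c q c<upper)) (proj₂ (proj₂ bounds))

0ₑ : ∀ {n} → Exp n
0ₑ {n} = Vec.replicate n (+ 0)

module _ where
  open ℤSolver.+-*-Solver using () renaming (solve to solveℤ; _:+_ to _:+ℤ_; _:-_ to _:-ℤ_; _:=_ to _:=ℤ_)

  [e+v]-v≡e : ∀ {n} (e v : Exp n) → (e +ₑ v) -ₑ v ≡ e
  [e+v]-v≡e [] [] = refl
  [e+v]-v≡e (a ∷ e) (b ∷ v) = cong₂ _∷_ (solveℤ 2 (λ a b → (a :+ℤ b) :-ℤ b :=ℤ a) refl a b) ([e+v]-v≡e e v)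

  [k-v]+v≡k : ∀ {n} (k v : Exp n) → (k -ₑ v) +ₑ v ≡ k
  [k-v]+v≡k [] [] = refl
  [k-v]+v≡k (a ∷ k) (b ∷ v) = cong₂ _∷_ (solveℤ 2 (λ a b → (a :-ℤ b) :+ℤ b :=ℤ a) refl a b) ([k-v]+v≡k k v)

  e+[k-e]≡k : ∀ {n} (e k : Exp n) → e +ₑ (k -ₑ e) ≡ k
  e+[k-e]≡k [] [] = refl
  e+[k-e]≡k (a ∷ e) (b ∷ k) = cong₂ _∷_ (solveℤ 2 (λ a b → a :+ℤ (b :-ℤ a) :=ℤ b) refl a b) (e+[k-e]≡k e k)

+ₑ-comm : ∀ {n} (e f : Exp n) → e +ₑ f ≡ f +ₑ e
+ₑ-comm [] [] = refl
+ₑ-comm (a ∷ e) (b ∷ f) = cong₂ _∷_ (ℤP.+-comm a b) (+ₑ-comm e f)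

-ₑ-inverse : ∀ {n} (e : Exp n) → e -ₑ e ≡ 0ₑ
-ₑ-inverse [] = refl
-ₑ-inverse (a ∷ e) = cong₂ _∷_ (ℤP.+-inverseʳ a) (-ₑ-inverse e)

+ₑ-identityˡ : ∀ {n} (v : Exp n) → 0ₑ +ₑ v ≡ v
+ₑ-identityˡ [] = refl
+ₑ-identityˡ (a ∷ v) = cong₂ _∷_ (ℤP.+-identityˡ a) (+ₑ-identityˡ v)

·ₑ-identityˡ : ∀ {n} (m : Exp n) → 1 ·ₑ m ≡ m
·ₑ-identityˡ [] = refl
·ₑ-identityˡ (a ∷ m) = cong₂ _∷_ (ℤP.*-identityˡ a) (·ₑ-identityˡ m)

k-v≡e⇔k≡e+v : ∀ {n} {k v e : Exp n} → (k -ₑ v ≡ e → k ≡ e +ₑ v) × (k ≡ e +ₑ v → k -ₑ v ≡ e)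
k-v≡e⇔k≡e+v {k = k} {v} {e} = (λ { refl → sym ([k-v]+v≡k k v) }) , (λ { refl → [e+v]-v≡e e v })

toℚᵛ-+ : ∀ {n} (x y : Exp n) → toℚᵛ (x +ₑ y) ≡ toℚᵛ x +ᵛ toℚᵛ y
toℚᵛ-+ [] [] = refl
toℚᵛ-+ (a ∷ x) (b ∷ y) = cong₂ _∷_ (toℚ-+ a b) (toℚᵛ-+ x y)

toℚᵛ-- : ∀ {n} (x y : Exp n) → toℚᵛ (x -ₑ y) ≡ toℚᵛ x -ᵛ toℚᵛ y
toℚᵛ-- [] [] = refl
toℚᵛ-- (a ∷ x) (b ∷ y) = cong₂ _∷_ (toℚ-- a b) (toℚᵛ-- x y)

toℚᵛ-· : ∀ {n} s (x : Exp n) → toℚᵛ (s ·ₑ x) ≡ toℚ (+ s) ·ᵛ toℚᵛ x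
toℚᵛ-· s [] = refl
toℚᵛ-· s (a ∷ x) = cong₂ _∷_ (toℚ-* (+ s) a) (toℚᵛ-· s x)

toℚᵛ-0 : ∀ {n} → toℚᵛ (0ₑ {n}) ≡ 0ᵛ
toℚᵛ-0 {zero} = refl
toℚᵛ-0 {suc n} = cong (0ℚ ∷_) (toℚᵛ-0 {n})

toℚᵛ-injective : ∀ {n} {x y : Exp n} → toℚᵛ x ≡ toℚᵛ y → x ≡ y
toℚᵛ-injective {x = []} {[]} _ = refl
toℚᵛ-injective {x = a ∷ x} {b ∷ y} eq =
  cong₂ _∷_ (toℚ-injective (cong Vec.head eq)) (toℚᵛ-injective (cong Vec.tail eq))

-- Comparing lexKey l x lexicographically orders points by l first and breaks ties lexicographically:
-- a total order compatible with addition, strict on distinct points.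

lexKey : ∀ {n} → Vec ℚ n → Vec ℚ n → Vec ℚ (suc n)
lexKey l y = dot l y ∷ y

lexKey-+ᵛ : ∀ {n} (l x y : Vec ℚ n) → lexKey l (x +ᵛ y) ≡ lexKey l x +ᵛ lexKey l y
lexKey-+ᵛ l x y = cong (_∷ _) (dot-+ᵛ l x y)

lexKey-·ᵛ : ∀ {n} (l : Vec ℚ n) c x → lexKey l (c ·ᵛ x) ≡ c ·ᵛ lexKey l x
lexKey-·ᵛ l c x = cong (_∷ _) (dot-·ᵛ l c x)

key : ∀ {n} → Vec ℚ n → Exp n → Vec ℚ (suc n)
key l e = lexKey l (toℚᵛ e)

key-+ₑ : ∀ {n} (l : Vec ℚ n) x y → key l (x +ₑ y) ≡ key l x +ᵛ key l y
key-+ₑ l x y = trans (cong (lexKey l) (toℚᵛ-+ x y)) (lexKey-+ᵛ l (toℚᵛ x) (toℚᵛ y))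

key--ₑ : ∀ {n} (l : Vec ℚ n) x y → key l (x -ₑ y) ≡ key l x -ᵛ key l y
key--ₑ l x y = trans (cong (lexKey l) (toℚᵛ-- x y)) (cong (_∷ _) (dot--ᵛ l (toℚᵛ x) (toℚᵛ y)))

key-·ₑ : ∀ {n} (l : Vec ℚ n) s x → key l (s ·ₑ x) ≡ toℚ (+ s) ·ᵛ key l x
key-·ₑ l s x = trans (cong (lexKey l) (toℚᵛ-· s x)) (lexKey-·ᵛ l (toℚ (+ s)) (toℚᵛ x))

key-0ₑ : ∀ {n} (l : Vec ℚ n) → key l 0ₑ ≡ 0ᵛ
key-0ₑ l = trans (cong (lexKey l) toℚᵛ-0) (cong (_∷ _) (dot-0ᵛ l))

key-≤ₗ-≢⇒<ₗ : ∀ {n} (l : Vec ℚ n) {k e} → key l k ≤ₗ key l e → k ≢ e → key l k <ₗ key l e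
key-≤ₗ-≢⇒<ₗ l (inj₁ k<e) _ = k<e
key-≤ₗ-≢⇒<ₗ l {k} {e} (inj₂ e-k≡0) k≢e =
  ⊥-elim (k≢e (sym (toℚᵛ-injective (cong Vec.tail (x-y≡0⇒x≡y {x = key l e} {key l k} e-k≡0)))))

-- Newton polytopes

ConvexWeights : ∀ {n} → LaurentPoly n → List (Exp n × ℚ) → Set
ConvexWeights R = All (λ kw → InSupport R (proj₁ kw) × 0ℚ ≤ proj₂ kw)

module _ {n} (Q : LaurentPoly n) (l : Vec ℚ n) (v : Exp n) (v∈Q : InSupport Q v)
         (v-max : ∀ k → InSupport Q k → k ≢ v → key l k <ₗ key l v) where

  private
    V = toℚᵛ v
    KV = lexKey l V

  combo-below : ∀ ws → ConvexWeights Q ws →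
    combo ws ≡ weightSum ws ·ᵛ V ⊎ lexKey l (combo ws) <ₗ weightSum ws ·ᵛ KV
  combo-below [] [] = inj₁ (sym (·ᵛ-zeroˡ V))
  combo-below ((k , c) ∷ ws) ((k∈Q , 0≤c) ∷ cw) = add term (combo-below ws cw)
    where
    term : c ·ᵛ toℚᵛ k ≡ c ·ᵛ V ⊎ lexKey l (c ·ᵛ toℚᵛ k) <ₗ c ·ᵛ KV
    term with k ≟ₑ v | ℚP.<-cmp 0ℚ c
    ... | yes refl | _ = inj₁ refl
    ... | no k≢v | tri< 0<c _ _ =
      inj₂ (subst (_<ₗ c ·ᵛ KV) (sym (lexKey-·ᵛ l c (toℚᵛ k))) (·ᵛ-mono-<ₗ {x = key l k} {KV} 0<c (v-max k k∈Q k≢v)))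
    ... | no _ | tri≈ _ refl _ = inj₁ (trans (·ᵛ-zeroˡ _) (sym (·ᵛ-zeroˡ V)))
    ... | no _ | tri> _ _ c<0 = ⊥-elim (ℚP.<-irrefl refl (ℚP.<-≤-trans c<0 0≤c))
    s = weightSum ws
    key-sum : lexKey l ((c ·ᵛ toℚᵛ k) +ᵛ combo ws) ≡ lexKey l (c ·ᵛ toℚᵛ k) +ᵛ lexKey l (combo ws)
    key-sum = lexKey-+ᵛ l (c ·ᵛ toℚᵛ k) (combo ws)
    bound-sum : (c ·ᵛ KV) +ᵛ (s ·ᵛ KV) ≡ (c + s) ·ᵛ KV
    bound-sum = sym (·ᵛ-distribʳ-+ c s KV)
    weak : combo ws ≡ s ·ᵛ V ⊎ lexKey l (combo ws) <ₗ s ·ᵛ KV → lexKey l (combo ws) ≤ₗ s ·ᵛ KV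
    weak (inj₁ eq) = ≤ₗ-reflexive (trans (cong (lexKey l) eq) (lexKey-·ᵛ l s V))
    weak (inj₂ lt) = inj₁ lt
    add : c ·ᵛ toℚᵛ k ≡ c ·ᵛ V ⊎ lexKey l (c ·ᵛ toℚᵛ k) <ₗ c ·ᵛ KV →
          combo ws ≡ s ·ᵛ V ⊎ lexKey l (combo ws) <ₗ s ·ᵛ KV →
          combo ((k , c) ∷ ws) ≡ (c + s) ·ᵛ V ⊎ lexKey l (combo ((k , c) ∷ ws)) <ₗ (c + s) ·ᵛ KV
    add (inj₁ eq₁) (inj₁ eq₂) = inj₁ (trans (cong₂ _+ᵛ_ eq₁ eq₂) (sym (·ᵛ-distribʳ-+ c s V)))
    add (inj₁ eq₁) (inj₂ lt₂) = inj₂ (subst₂ _<ₗ_ (sym key-sum) bound-sum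
      (+ᵛ-mono-≤-<ₗ {x₁ = lexKey l (c ·ᵛ toℚᵛ k)} {lexKey l (combo ws)} {c ·ᵛ KV} {s ·ᵛ KV} (≤ₗ-reflexive (trans (cong (lexKey l) eq₁) (lexKey-·ᵛ l c V))) lt₂))
    add (inj₂ lt₁) r = inj₂ (subst₂ _<ₗ_ (sym key-sum) bound-sum (+ᵛ-mono-<-≤ₗ {x₁ = lexKey l (c ·ᵛ toℚᵛ k)} {lexKey l (combo ws)} {c ·ᵛ KV} {s ·ᵛ KV} lt₁ (weak r)))

  InNewton-below : ∀ a → InNewton Q a → a ≡ V ⊎ lexKey l a <ₗ KV
  InNewton-below a (ws , cw , Σw≡1 , combo≡a) with combo-below ws cw
  ... | inj₁ eq = inj₁ (trans (sym combo≡a) (trans eq (trans (cong (_·ᵛ V) Σw≡1) (·ᵛ-identityˡ V))))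
  ... | inj₂ lt = inj₂ (subst₂ _<ₗ_ (cong (lexKey l) combo≡a) (trans (cong (_·ᵛ KV) Σw≡1) (·ᵛ-identityˡ KV)) lt)

  -- A strict inequality on either side of a proper convex combination would make KV <ₗ KV.
  key-max⇒IsVertex : IsVertex Q v
  key-max⇒IsVertex = ((v , 1ℚ) ∷ [] , (v∈Q , 0≤1) ∷ [] , ℚP.+-identityʳ 1ℚ , trans (+ᵛ-identityʳ _) (·ᵛ-identityˡ V)) , extreme
    where
    extreme : ∀ a b t → InNewton Q a → InNewton Q b → 0ℚ < t → t < 1ℚ →
              V ≡ (t ·ᵛ a) +ᵛ ((1ℚ - t) ·ᵛ b) → a ≡ V × b ≡ V
    extreme a b t a∈Q b∈Q 0<t t<1 V≡ = both (InNewton-below a a∈Q) (InNewton-below b b∈Q)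
      where
      Ka = lexKey l a
      Kb = lexKey l b
      KV≡ : (t ·ᵛ Ka) +ᵛ ((1ℚ - t) ·ᵛ Kb) ≡ KV
      KV≡ = sym (trans (cong (lexKey l) V≡)
        (trans (lexKey-+ᵛ l (t ·ᵛ a) ((1ℚ - t) ·ᵛ b)) (cong₂ _+ᵛ_ (lexKey-·ᵛ l t a) (lexKey-·ᵛ l (1ℚ - t) b))))
      absurd : (t ·ᵛ Ka) +ᵛ ((1ℚ - t) ·ᵛ Kb) <ₗ (t ·ᵛ KV) +ᵛ ((1ℚ - t) ·ᵛ KV) → ⊥
      absurd lt = <ₗ-irrefl KV (subst₂ _<ₗ_ KV≡ (tx+[1-t]x≡x t KV) lt)
      weak : a ≡ V ⊎ Ka <ₗ KV → Ka ≤ₗ KV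
      weak (inj₁ refl) = ≤ₗ-refl KV
      weak (inj₂ lt) = inj₁ lt
      both : a ≡ V ⊎ Ka <ₗ KV → b ≡ V ⊎ Kb <ₗ KV → a ≡ V × b ≡ V
      both (inj₁ a≡V) (inj₁ b≡V) = a≡V , b≡V
      both ha (inj₂ Kb<KV) =
        ⊥-elim (absurd (+ᵛ-mono-≤-<ₗ {x₁ = t ·ᵛ Ka} {(1ℚ - t) ·ᵛ Kb} {t ·ᵛ KV} {(1ℚ - t) ·ᵛ KV}
          (·ᵛ-mono-≤ₗ {x = Ka} {KV} (ℚP.<⇒≤ 0<t) (weak ha)) (·ᵛ-mono-<ₗ {x = Kb} {KV} (<⇒0<- t<1) Kb<KV)))
      both (inj₂ Ka<KV) (inj₁ refl) =
        ⊥-elim (absurd (+ᵛ-mono-<-≤ₗ {x₁ = t ·ᵛ Ka} {(1ℚ - t) ·ᵛ KV} {t ·ᵛ KV} {(1ℚ - t) ·ᵛ KV}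
          (·ᵛ-mono-<ₗ {x = Ka} {KV} 0<t Ka<KV) (≤ₗ-refl ((1ℚ - t) ·ᵛ KV))))

combo≡vsum : ∀ {n} (ws : List (Exp n × ℚ)) → combo ws ≡ vsum toℚᵛ ws
combo≡vsum [] = refl
combo≡vsum ((k , w) ∷ ws) = cong ((w ·ᵛ toℚᵛ k) +ᵛ_) (combo≡vsum ws)

weightSum≡wsum : ∀ {n} (ws : List (Exp n × ℚ)) → weightSum ws ≡ wsum ws
weightSum≡wsum [] = refl
weightSum≡wsum ((k , w) ∷ ws) = cong (λ z → w + z) (weightSum≡wsum ws)

vsum-[a-u] : ∀ {I : Set} {m} (a : Vec ℚ m) (u : I → Vec ℚ m) ws →
  vsum (λ i → a -ᵛ u i) ws ≡ (wsum ws ·ᵛ a) -ᵛ vsum u ws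
vsum-[a-u] a u [] = sym (trans (cong (_-ᵛ 0ᵛ) (·ᵛ-zeroˡ a)) (-ᵛ-inverse 0ᵛ))
vsum-[a-u] a u ((i , y) ∷ ws) = trans (cong ((y ·ᵛ (a -ᵛ u i)) +ᵛ_) (vsum-[a-u] a u ws)) (regroup y (wsum ws) a (u i) (vsum u ws))
  where
  regroup : ∀ {m} y s (a x z : Vec ℚ m) → (y ·ᵛ (a -ᵛ x)) +ᵛ ((s ·ᵛ a) -ᵛ z) ≡ ((y + s) ·ᵛ a) -ᵛ ((y ·ᵛ x) +ᵛ z)
  regroup y s [] [] [] = refl
  regroup y s (b ∷ a) (c ∷ x) (d ∷ z) = cong₂ _∷_
    (solve 5 (λ y s b c d → y :* (b :- c) :+ (s :* b :- d) := (y :+ s) :* b :- (y :* c :+ d)) refl y s b c d)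
    (regroup y s a x z)

scaleWeight : ∀ {n} → ℚ → Exp n × ℚ → Exp n × ℚ
scaleWeight t (k , w) = k , t * w

combo-scale : ∀ {n} t (ws : List (Exp n × ℚ)) → combo (List.map (scaleWeight t) ws) ≡ t ·ᵛ combo ws
combo-scale t [] = sym (·ᵛ-zeroʳ t)
combo-scale t ((k , w) ∷ ws) =
  trans (cong₂ _+ᵛ_ (sym (·ᵛ-assoc t w (toℚᵛ k))) (combo-scale t ws)) (sym (·ᵛ-distribˡ-+ᵛ t _ (combo ws)))

weightSum-scale : ∀ {n} t (ws : List (Exp n × ℚ)) → weightSum (List.map (scaleWeight t) ws) ≡ t * weightSum ws
weightSum-scale t [] = sym (ℚP.*-zeroʳ t)
weightSum-scale t ((k , w) ∷ ws) = trans (cong (λ z → t * w + z) (weightSum-scale t ws)) (sym (ℚP.*-distribˡ-+ t w _))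

ConvexWeights-scale : ∀ {n} {R : LaurentPoly n} {t} ws → 0ℚ ≤ t → ConvexWeights R ws → ConvexWeights R (List.map (scaleWeight t) ws)
ConvexWeights-scale ws 0≤t cw = AllP.map⁺ (All.map (λ { (k∈R , 0≤w) → k∈R , *-nonNeg 0≤t 0≤w }) cw)

combo-++ : ∀ {n} (xs ys : List (Exp n × ℚ)) → combo (xs ++ ys) ≡ combo xs +ᵛ combo ys
combo-++ [] ys = sym (+ᵛ-identityˡ _)
combo-++ ((k , w) ∷ xs) ys = trans (cong ((w ·ᵛ toℚᵛ k) +ᵛ_) (combo-++ xs ys)) (sym (+ᵛ-assoc _ (combo xs) (combo ys)))

weightSum-++ : ∀ {n} (xs ys : List (Exp n × ℚ)) → weightSum (xs ++ ys) ≡ weightSum xs + weightSum ys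
weightSum-++ [] ys = sym (ℚP.+-identityˡ _)
weightSum-++ ((k , w) ∷ xs) ys = trans (cong (λ z → w + z) (weightSum-++ xs ys)) (sym (ℚP.+-assoc w (weightSum xs) (weightSum ys)))

vanishing-combination⇒InNewton : ∀ {n} (Q : LaurentPoly n) (a : Exp n) ws → ConvexWeights Q ws → 0ℚ < wsum ws →
  vsum (λ q → toℚᵛ a -ᵛ toℚᵛ q) ws ≡ 0ᵛ → InNewton Q (toℚᵛ a)
vanishing-combination⇒InNewton Q a ws cw 0<S S≡0 =
  List.map (scaleWeight (inv S)) ws , ConvexWeights-scale {R = Q} ws (ℚP.<⇒≤ (inv-pos S 0<S)) cw , weights≡1 , combo≡a
  where
  A = toℚᵛ a
  S = wsum ws
  inv[S]S≡1 : inv S * S ≡ 1ℚ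
  inv[S]S≡1 = inv-inverseˡ S (0<⇒≢0 0<S)
  weights≡1 : weightSum (List.map (scaleWeight (inv S)) ws) ≡ 1ℚ
  weights≡1 = trans (weightSum-scale (inv S) ws) (trans (cong (inv S *_) (weightSum≡wsum ws)) inv[S]S≡1)
  SA≡combo : S ·ᵛ A ≡ combo ws
  SA≡combo = trans (x-y≡0⇒x≡y (trans (sym (vsum-[a-u] A toℚᵛ ws)) S≡0)) (sym (combo≡vsum ws))
  combo≡a : combo (List.map (scaleWeight (inv S)) ws) ≡ A
  combo≡a = begin
    combo (List.map (scaleWeight (inv S)) ws)  ≡⟨ combo-scale (inv S) ws ⟩
    inv S ·ᵛ combo ws                          ≡⟨ cong (inv S ·ᵛ_) (sym SA≡combo) ⟩
    inv S ·ᵛ (S ·ᵛ A)                          ≡⟨ ·ᵛ-assoc (inv S) S A ⟩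
    (inv S * S) ·ᵛ A                           ≡⟨ cong (_·ᵛ A) inv[S]S≡1 ⟩
    1ℚ ·ᵛ A                                    ≡⟨ ·ᵛ-identityˡ A ⟩
    A                                          ∎
    where open ≡-Reasoning

support⊆Newton⇒NewtonSubset : ∀ {n} (P Q : LaurentPoly n) →
  (∀ a → InSupport P a → InNewton Q (toℚᵛ a)) → NewtonSubset P Q
support⊆Newton⇒NewtonSubset {n} P Q supp⊆ x (ws , cw , Σw≡1 , combo≡x) with substitute ws cw
  where
  substitute : ∀ ws → ConvexWeights P ws →
    Σ (List (Exp n × ℚ)) λ vs → ConvexWeights Q vs × weightSum vs ≡ weightSum ws × combo vs ≡ combo ws
  substitute [] [] = [] , [] , refl , refl
  substitute ((a , t) ∷ ws) ((a∈P , 0≤t) ∷ cw) with supp⊆ a a∈P | substitute ws cw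
  ... | us , cu , Σu≡1 , combo≡a | vs , cv , Σv≡ , combo-vs≡ =
    List.map (scaleWeight t) us ++ vs ,
    AllP.++⁺ (ConvexWeights-scale {R = Q} us 0≤t cu) cv ,
    trans (weightSum-++ (List.map (scaleWeight t) us) vs)
          (cong₂ _+_ (trans (weightSum-scale t us) (trans (cong (t *_) Σu≡1) (ℚP.*-identityʳ t))) Σv≡) ,
    trans (combo-++ (List.map (scaleWeight t) us) vs)
          (cong₂ _+ᵛ_ (trans (combo-scale t us) (cong (t ·ᵛ_) combo≡a)) combo-vs≡)
... | vs , cv , Σv≡ , combo-vs≡ = vs , cv , trans Σv≡ Σw≡1 , trans combo-vs≡ combo≡x

without : ∀ {n} {A : Set} → Exp n → List (Exp n × A) → List (Exp n × A)
without v = List.filter (λ kc → ¬? (proj₁ kc ≟ₑ v))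

coeff-without-self : ∀ {n} (v : Exp n) R → coeff (without v R) v ≡ + 0
coeff-without-self v [] = refl
coeff-without-self v ((k , c) ∷ R) with k ≟ₑ v
... | yes _ = coeff-without-self v R
... | no k≢v with k ≟ₑ v
...   | yes k≡v = ⊥-elim (k≢v k≡v)
...   | no _ = coeff-without-self v R

coeff-without-other : ∀ {n} (v : Exp n) R k → k ≢ v → coeff (without v R) k ≡ coeff R k
coeff-without-other v [] k k≢v = refl
coeff-without-other v ((e , c) ∷ R) k k≢v with e ≟ₑ v
... | yes refl with e ≟ₑ k
...   | yes refl = ⊥-elim (k≢v refl)
...   | no _ = coeff-without-other v R k k≢v
coeff-without-other v ((e , c) ∷ R) k k≢v | no _ with e ≟ₑ k
...   | yes _ = cong (λ z → c ℤ.+ z) (coeff-without-other v R k k≢v)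
...   | no _ = coeff-without-other v R k k≢v

coeffℚ-without-self : ∀ {n} (v : Exp n) X → coeffℚ (without v X) v ≡ 0ℚ
coeffℚ-without-self v [] = refl
coeffℚ-without-self v ((k , c) ∷ X) with k ≟ₑ v
... | yes _ = coeffℚ-without-self v X
... | no k≢v with k ≟ₑ v
...   | yes k≡v = ⊥-elim (k≢v k≡v)
...   | no _ = coeffℚ-without-self v X

coeffℚ-without-other : ∀ {n} (v : Exp n) X k → k ≢ v → coeffℚ (without v X) k ≡ coeffℚ X k
coeffℚ-without-other v [] k k≢v = refl
coeffℚ-without-other v ((e , c) ∷ X) k k≢v with e ≟ₑ v
... | yes refl with e ≟ₑ k
...   | yes refl = ⊥-elim (k≢v refl)
...   | no _ = coeffℚ-without-other v X k k≢v
coeffℚ-without-other v ((e , c) ∷ X) k k≢v | no _ with e ≟ₑ k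
...   | yes _ = cong (λ z → c + z) (coeffℚ-without-other v X k k≢v)
...   | no _ = coeffℚ-without-other v X k k≢v

coeffℚ-++ : ∀ {n} (X Y : QPoly n) k → coeffℚ (X ++ Y) k ≡ coeffℚ X k + coeffℚ Y k
coeffℚ-++ [] Y k = sym (ℚP.+-identityˡ _)
coeffℚ-++ ((e , c) ∷ X) Y k with e ≟ₑ k
... | yes _ = trans (cong (λ z → c + z) (coeffℚ-++ X Y k)) (sym (ℚP.+-assoc c _ _))
... | no _ = coeffℚ-++ X Y k

pairing : ∀ {n} → QPoly n → (Exp n → ℚ) → ℚ
pairing [] g = 0ℚ
pairing ((e , c) ∷ X) g = c * g e + pairing X g

pairing-without : ∀ {n} (e₀ : Exp n) X g → pairing X g ≡ coeffℚ X e₀ * g e₀ + pairing (without e₀ X) g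
pairing-without e₀ [] g = sym (trans (cong (_+ 0ℚ) (ℚP.*-zeroˡ (g e₀))) (ℚP.+-identityˡ 0ℚ))
pairing-without e₀ ((e , c) ∷ X) g with e ≟ₑ e₀
... | yes refl rewrite pairing-without e X g =
  solve 4 (λ c ge r s → c :* ge :+ (r :* ge :+ s) := (c :+ r) :* ge :+ s) refl c (g e) (coeffℚ X e) (pairing (without e X) g)
... | no _ rewrite pairing-without e₀ X g =
  solve 5 (λ c ge r g₀ s → c :* ge :+ (r :* g₀ :+ s) := r :* g₀ :+ (c :* ge :+ s))
          refl c (g e) (coeffℚ X e₀) (g e₀) (pairing (without e₀ X) g)

pairing≢0⇒ : ∀ {n} (X : QPoly n) g → pairing X g ≢ 0ℚ → Σ (Exp n) λ e → coeffℚ X e ≢ 0ℚ × g e ≢ 0ℚ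
pairing≢0⇒ X g = go (List.length X) X ℕP.≤-refl
  where
  go : ∀ fuel X → List.length X ℕ.≤ fuel → pairing X g ≢ 0ℚ → Σ _ λ e → coeffℚ X e ≢ 0ℚ × g e ≢ 0ℚ
  go _ [] _ ≢0 = ⊥-elim (≢0 refl)
  go (suc fuel) X@((e₀ , c) ∷ X′) (ℕ.s≤s len) ≢0 with (coeffℚ X e₀ * g e₀) ℚP.≟ 0ℚ
  ... | no term≢0 = e₀ , *-≢0-inv term≢0
  ... | yes term≡0 with go fuel (without e₀ X) shorter
                         (λ rest≡0 → ≢0 (trans (pairing-without e₀ X g) (cong₂ _+_ term≡0 rest≡0)))
    where
    shorter : List.length (without e₀ X) ℕ.≤ fuel
    shorter with e₀ ≟ₑ e₀
    ... | yes _ = ℕP.≤-trans (ListP.length-filter _ X′) len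
    ... | no e₀≢e₀ = ⊥-elim (e₀≢e₀ refl)
  ...   | e , X[e]≢0 , g[e]≢0 with e ≟ₑ e₀
  ...     | yes refl = ⊥-elim (X[e]≢0 (coeffℚ-without-self e X))
  ...     | no e≢e₀ = e , subst (_≢ 0ℚ) (coeffℚ-without-other e₀ X e e≢e₀) X[e]≢0 , g[e]≢0

e+f≡k⇔f≡k-e : ∀ {n} {e f k : Exp n} → (e +ₑ f ≡ k → f ≡ k -ₑ e) × (f ≡ k -ₑ e → e +ₑ f ≡ k)
e+f≡k⇔f≡k-e {e = e} {f} {k} = (λ { refl → sym (trans (cong (_-ₑ e) (+ₑ-comm e f)) ([e+v]-v≡e f e)) }) ,
                               (λ { refl → e+[k-e]≡k e k })

coeffℚ-mulQ-monomial : ∀ {n} (e : Exp n) c Y k → coeffℚ (mulQ ((e , c) ∷ []) Y) k ≡ c * coeffℚ Y (k -ₑ e)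
coeffℚ-mulQ-monomial e c [] k = sym (ℚP.*-zeroʳ c)
coeffℚ-mulQ-monomial e c ((f , d) ∷ Y) k with (e +ₑ f) ≟ₑ k | f ≟ₑ (k -ₑ e)
... | yes _ | yes _ = trans (cong (λ z → c * d + z) (coeffℚ-mulQ-monomial e c Y k)) (sym (ℚP.*-distribˡ-+ c d _))
... | yes p | no q = ⊥-elim (q (proj₁ e+f≡k⇔f≡k-e p))
... | no p | yes q = ⊥-elim (p (proj₂ e+f≡k⇔f≡k-e q))
... | no _ | no _ = coeffℚ-mulQ-monomial e c Y k

mulQ-cons : ∀ {n} (y : Exp n × ℚ) X Y → mulQ (y ∷ X) Y ≡ mulQ (y ∷ []) Y ++ mulQ X Y
mulQ-cons y X Y = cong (_++ mulQ X Y) (sym (ListP.++-identityʳ _))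

coeffℚ-mulQ : ∀ {n} (X Y : QPoly n) k → coeffℚ (mulQ X Y) k ≡ pairing X (λ e → coeffℚ Y (k -ₑ e))
coeffℚ-mulQ [] Y k = refl
coeffℚ-mulQ ((e , c) ∷ X) Y k = begin
  coeffℚ (mulQ ((e , c) ∷ X) Y) k                          ≡⟨ cong (λ L → coeffℚ L k) (mulQ-cons (e , c) X Y) ⟩
  coeffℚ (mulQ ((e , c) ∷ []) Y ++ mulQ X Y) k             ≡⟨ coeffℚ-++ (mulQ ((e , c) ∷ []) Y) (mulQ X Y) k ⟩
  coeffℚ (mulQ ((e , c) ∷ []) Y) k + coeffℚ (mulQ X Y) k  ≡⟨ cong₂ _+_ (coeffℚ-mulQ-monomial e c Y k) (coeffℚ-mulQ X Y k) ⟩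
  c * coeffℚ Y (k -ₑ e) + pairing X (λ e → coeffℚ Y (k -ₑ e))  ∎
  where open ≡-Reasoning

coeffℚ-shift : ∀ {n} (v : Exp n) (φ : ℤ → ℚ) → (∀ a b → φ (a ℤ.+ b) ≡ φ a + φ b) → φ (+ 0) ≡ 0ℚ →
  {f : Exp n × ℤ → Exp n × ℚ} → (∀ x → f x ≡ (proj₁ x -ₑ v , φ (proj₂ x))) →
  ∀ R e → coeffℚ (List.map f R) e ≡ φ (coeff R (e +ₑ v))
coeffℚ-shift v φ φ-+ φ-0 f≡ [] e = sym φ-0
coeffℚ-shift v φ φ-+ φ-0 f≡ ((k , c) ∷ R) e rewrite f≡ (k , c) with (k -ₑ v) ≟ₑ e | k ≟ₑ (e +ₑ v)
... | yes _ | yes _ = trans (cong (λ z → φ c + z) (coeffℚ-shift v φ φ-+ φ-0 f≡ R e)) (sym (φ-+ c _))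
... | yes p | no q = ⊥-elim (q (proj₁ k-v≡e⇔k≡e+v p))
... | no p | yes q = ⊥-elim (p (proj₂ k-v≡e⇔k≡e+v q))
... | no _ | no _ = coeffℚ-shift v φ φ-+ φ-0 f≡ R e

coeffℚ-oneQ-0ₑ : ∀ {n} → coeffℚ (oneQ {n}) 0ₑ ≡ 1ℚ
coeffℚ-oneQ-0ₑ {n} with (0ₑ {n}) ≟ₑ 0ₑ
... | yes _ = ℚP.+-identityʳ 1ℚ
... | no 0≢0 = ⊥-elim (0≢0 refl)

coeffℚ-oneQ-≢0ₑ : ∀ {n} (e : Exp n) → e ≢ 0ₑ → coeffℚ (oneQ {n}) e ≡ 0ℚ
coeffℚ-oneQ-≢0ₑ {n} e e≢0 with (0ₑ {n}) ≟ₑ e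
... | yes 0≡e = ⊥-elim (e≢0 (sym 0≡e))
... | no _ = refl

Pos-antisym : ∀ {m} {x : Vec ℚ m} → Pos x → Pos (0ᵛ -ᵛ x) → ⊥
Pos-antisym {x = x} px p-x = ¬Pos-0ᵛ (subst Pos (x+[0-x]≡0 x) (Pos-+ᵛ px p-x))
  where
  x+[0-x]≡0 : ∀ {m} (x : Vec ℚ m) → x +ᵛ (0ᵛ -ᵛ x) ≡ 0ᵛ
  x+[0-x]≡0 [] = refl
  x+[0-x]≡0 (a ∷ x) = cong₂ _∷_ (solve 1 (λ a → a :+ (con 0ℚ :- a) := con 0ℚ) refl a) (x+[0-x]≡0 x)

module GeometricSum {n m} (A : QPoly n) (K : Exp n → Vec ℚ m)
  (K-+ : ∀ x y → K (x +ₑ y) ≡ K x +ᵛ K y) (K-0 : K 0ₑ ≡ 0ᵛ)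
  (A-negative : ∀ e → coeffℚ A e ≢ 0ℚ → Pos (0ᵛ -ᵛ K e)) where

  private
    0-K0≡0 : 0ᵛ -ᵛ K 0ₑ ≡ 0ᵛ
    0-K0≡0 = trans (cong (0ᵛ -ᵛ_) K-0) (-ᵛ-inverse 0ᵛ)

    [0-x]+[0-y]≡0-[x+y] : ∀ {k} (x y : Vec ℚ k) → (0ᵛ -ᵛ x) +ᵛ (0ᵛ -ᵛ y) ≡ 0ᵛ -ᵛ (x +ᵛ y)
    [0-x]+[0-y]≡0-[x+y] [] [] = refl
    [0-x]+[0-y]≡0-[x+y] (a ∷ x) (b ∷ y) =
      cong₂ _∷_ (solve 2 (λ a b → (con 0ℚ :- a) :+ (con 0ℚ :- b) := con 0ℚ :- (a :+ b)) refl a b) ([0-x]+[0-y]≡0-[x+y] x y)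

  mutual
    powQ-nonPositive : ∀ M e → coeffℚ (powQ A M) e ≢ 0ℚ → NonNeg (0ᵛ -ᵛ K e)
    powQ-nonPositive zero e ≢0 with e ≟ₑ 0ₑ
    ... | yes refl = inj₂ 0-K0≡0
    ... | no e≢0 = ⊥-elim (≢0 (coeffℚ-oneQ-≢0ₑ e e≢0))
    powQ-nonPositive (suc M) e ≢0 = inj₁ (powQ-negative M e ≢0)

    powQ-negative : ∀ M e → coeffℚ (powQ A (suc M)) e ≢ 0ℚ → Pos (0ᵛ -ᵛ K e)
    powQ-negative M e ≢0 with pairing≢0⇒ A (λ e₁ → coeffℚ (powQ A M) (e -ₑ e₁)) (≢0 ∘ trans (coeffℚ-mulQ A (powQ A M) e))
    ... | e₁ , A[e₁]≢0 , Aᴹ[e-e₁]≢0 =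
      subst Pos (trans ([0-x]+[0-y]≡0-[x+y] (K e₁) (K (e -ₑ e₁))) (cong (0ᵛ -ᵛ_) (trans (sym (K-+ e₁ (e -ₑ e₁))) (cong K (e+[k-e]≡k e₁ e)))))
        (Pos-+ᵛ-NonNeg (A-negative e₁ A[e₁]≢0) (powQ-nonPositive M (e -ₑ e₁) Aᴹ[e-e₁]≢0))

  powQ-suc-0ₑ : ∀ M → coeffℚ (powQ A (suc M)) 0ₑ ≡ 0ℚ
  powQ-suc-0ₑ M with coeffℚ (powQ A (suc M)) 0ₑ ℚP.≟ 0ℚ
  ... | yes ≡0 = ≡0
  ... | no ≢0 = ⊥-elim (¬Pos-0ᵛ (subst Pos 0-K0≡0 (powQ-negative M 0ₑ ≢0)))

  powQ-suc-positive : ∀ M e → Pos (K e) → coeffℚ (powQ A (suc M)) e ≡ 0ℚ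
  powQ-suc-positive M e pos with coeffℚ (powQ A (suc M)) e ℚP.≟ 0ℚ
  ... | yes ≡0 = ≡0
  ... | no ≢0 = ⊥-elim (Pos-antisym pos (powQ-negative M e ≢0))

  geomQ-positive : ∀ M e → Pos (K e) → coeffℚ (geomQ A M) e ≡ 0ℚ
  geomQ-positive zero e pos = coeffℚ-oneQ-≢0ₑ e (λ { refl → ¬Pos-0ᵛ (subst Pos K-0 pos) })
  geomQ-positive (suc M) e pos = trans (coeffℚ-++ (powQ A (suc M)) (geomQ A M) e)
    (trans (cong₂ _+_ (powQ-suc-positive M e pos) (geomQ-positive M e pos)) (ℚP.+-identityʳ 0ℚ))

  geomQ-0ₑ : ∀ M → coeffℚ (geomQ A M) 0ₑ ≡ 1ℚ
  geomQ-0ₑ zero = coeffℚ-oneQ-0ₑ {n}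
  geomQ-0ₑ (suc M) = trans (coeffℚ-++ (powQ A (suc M)) (geomQ A M) 0ₑ)
    (trans (cong₂ _+_ (powQ-suc-0ₑ M) (geomQ-0ₑ M)) (ℚP.+-identityˡ 1ℚ))

-- Gauss congruences fail at an isolated nonzero coefficient

m≤n⇒m∣n! : ∀ {m n} → 1 ℕ.≤ m → m ℕ.≤ n → m ℕDiv.∣ n ℕ.!
m≤n⇒m∣n! {suc k} _ m≤n = ℕDiv.∣-trans (ℕDiv.m∣m*n (k ℕ.!)) (ℕDiv.m≤n⇒m!∣n! m≤n)

-- Euclid: a prime factor of N! + 1 exceeds N.
prime-above : ∀ N → Σ ℕ λ p → Prime p × N ℕ.< p
prime-above N = first-factor (PrimeFactorisation.factors F) (PrimeFactorisation.isFactorisation F) (PrimeFactorisation.factorsPrime F)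
  where
  instance
    N!+1≢0 : ℕ.NonZero (N ℕ.! ℕ.+ 1)
    N!+1≢0 = ℕ.>-nonZero (ℕP.m≤n+m 1 (N ℕ.!))
  F = factorise (N ℕ.! ℕ.+ 1)
  first-factor : (fs : List ℕ) → N ℕ.! ℕ.+ 1 ≡ product fs → All Prime fs → Σ ℕ λ p → Prime p × N ℕ.< p
  first-factor [] N!+1≡1 _ with subst (2 ℕ.≤_) N!+1≡1 (ℕP.+-monoˡ-≤ 1 (ℕP.1≤n! N))
  ... | ℕ.s≤s ()
  first-factor (p ∷ fs) N!+1≡ (p-prime ∷ _) with N ℕ.<? p
  ... | yes N<p = p , p-prime , N<p
  ... | no N≮p = ⊥-elim (ℕP.<-irrefl (sym p≡1) 1<p)
    where
    1<p : 1 ℕ.< p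
    1<p = ℕ.nonTrivial⇒n>1 p {{prime⇒nonTrivial p-prime}}
    p≡1 : p ≡ 1
    p≡1 = ℕDiv.∣1⇒≡1 (ℕDiv.∣m+n∣m⇒∣n (subst (p ℕDiv.∣_) (sym N!+1≡) (ℕDiv.m∣m*n (product fs)))
                                     (m≤n⇒m∣n! (ℕP.<⇒≤ 1<p) (ℕP.≮⇒≥ N≮p)))

-- For r = 1 and a prime p above the threshold and above the numerator of b,
-- the congruence f_{p t} ≡ f_t (mod p) reads p ∣ ↥ b.
¬GaussProperty : ∀ {n} (F : Exp n → ℚ → Set) (t : Exp n) (b : ℚ) → b ≢ 0ℚ → F t b →
  (∀ s → 2 ℕ.≤ s → F (s ·ₑ t) 0ℚ) → ¬ GaussProperty F
¬GaussProperty F t b b≢0 F[t]≡b F[st]≡0 (B , gauss) = ℕP.<-irrefl refl (ℕP.<-≤-trans ∣↥b∣<p p≤∣↥b∣)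
  where
  large = prime-above (B ℕ.+ ℤ.∣ ↥ b ∣)
  p = proj₁ large
  p-prime = proj₁ (proj₂ large)
  B<p : B ℕ.< p
  B<p = ℕP.≤-<-trans (ℕP.m≤m+n B _) (proj₂ (proj₂ large))
  ∣↥b∣<p : ℤ.∣ ↥ b ∣ ℕ.< p
  ∣↥b∣<p = ℕP.≤-<-trans (ℕP.m≤n+m _ B) (proj₂ (proj₂ large))
  p¹≡p : p ℕ.^ 1 ≡ p
  p¹≡p = ℕP.*-identityʳ p
  2≤p¹ : 2 ℕ.≤ p ℕ.^ 1
  2≤p¹ = subst (2 ℕ.≤_) (sym p¹≡p) (ℕ.nonTrivial⇒n>1 p {{prime⇒nonTrivial p-prime}})
  p∣0-b : CongPow p 1 0ℚ b
  p∣0-b = proj₂ (gauss p p-prime B<p) t 1 0ℚ b (ℕ.s≤s ℕ.z≤n) (F[st]≡0 (p ℕ.^ 1) 2≤p¹) (subst (λ e → F e b) (sym (·ₑ-identityˡ t)) F[t]≡b)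
  ∣↥[0-b]∣≡∣↥b∣ : ℤ.∣ ↥ (0ℚ - b) ∣ ≡ ℤ.∣ ↥ b ∣
  ∣↥[0-b]∣≡∣↥b∣ = trans (cong (λ z → ℤ.∣ ↥ z ∣) (ℚP.+-identityˡ (- b))) (trans (cong ℤ.∣_∣ (ℚP.↥-neg b)) (ℤP.∣-i∣≡∣i∣ (↥ b)))
  ∣↥b∣≢0 : ℤ.∣ ↥ b ∣ ≢ 0
  ∣↥b∣≢0 ∣↥b∣≡0 = b≢0 (ℚP.↥p≡0⇒p≡0 b (ℤP.∣i∣≡0⇒i≡0 ∣↥b∣≡0))
  p≤∣↥b∣ : p ℕ.≤ ℤ.∣ ↥ b ∣
  p≤∣↥b∣ = ℕDiv.∣⇒≤ {{ℕ.≢-nonZero ∣↥b∣≢0}} (subst₂ ℕDiv._∣_ p¹≡p ∣↥[0-b]∣≡∣↥b∣ p∣0-b)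

support : ∀ {n} → LaurentPoly n → List (Exp n)
support R = List.filter (λ e → ¬? (coeff R e ℤ.≟ + 0)) (List.map proj₁ R)

All-InSupport-support : ∀ {n} (R : LaurentPoly n) → All (InSupport R) (support R)
All-InSupport-support R = AllP.all-filter _ (List.map proj₁ R)

InSupport⇒∈support : ∀ {n} (R : LaurentPoly n) k → InSupport R k → k ∈ support R
InSupport⇒∈support R k k∈R = ∈-filter⁺ (λ e → ¬? (coeff R e ℤ.≟ + 0)) (∈exponents R k∈R) k∈R
  where
  ∈exponents : ∀ R′ → coeff R′ k ≢ + 0 → k ∈ List.map proj₁ R′
  ∈exponents [] ≢0 = ⊥-elim (≢0 refl)
  ∈exponents ((e , c) ∷ R′) ≢0 with e ≟ₑ k
  ... | yes refl = here refl
  ... | no _ = there (∈exponents R′ ≢0)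

¬IsZeroPoly⇒InSupport : ∀ {n} (R : LaurentPoly n) → ¬ IsZeroPoly R → Σ (Exp n) (InSupport R)
¬IsZeroPoly⇒InSupport R R≢0 with support R | All-InSupport-support R | InSupport⇒∈support R
... | e ∷ _ | e∈R ∷ _ | _ = e , e∈R
... | [] | _ | ∈[] = ⊥-elim (R≢0 zero-coeff)
  where
  zero-coeff : ∀ k → coeff R k ≡ + 0
  zero-coeff k with coeff R k ℤ.≟ + 0
  ... | yes ≡0 = ≡0
  ... | no ≢0 with ∈[] k ≢0
  ...   | ()

key-argmax : ∀ {n} (l : Vec ℚ n) (R : LaurentPoly n) a → InSupport R a →
  Σ (Exp n) λ w → InSupport R w × key l a ≤ₗ key l w × (∀ k → InSupport R k → key l k ≤ₗ key l w)
key-argmax l R a a∈R with argmax _≤ₗ_ ≤ₗ-total ≤ₗ-refl ≤ₗ-trans (key l) a (support R)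
... | w , w∈ , w-max =
  w , All.lookup (a∈R ∷ All-InSupport-support R) w∈ , All.head w-max ,
  λ k k∈R → All.lookup (All.tail w-max) (InSupport⇒∈support R k k∈R)

-- The expansion of P/Q at a key-maximal vertex

module Expansion {n} (P Q : LaurentPoly n) (l : Vec ℚ n)
  (v : Exp n) (v∈Q : InSupport Q v) (v-max : ∀ k → InSupport Q k → k ≢ v → key l k <ₗ key l v)
  (w : Exp n) (w∈P : InSupport P w) (w-max : ∀ k → InSupport P k → key l k ≤ₗ key l w)
  (lv<lw : dot l (toℚᵛ v) < dot l (toℚᵛ w)) where

  K : Exp n → Vec ℚ (suc n)
  K = key l

  iq : ℚ
  iq = inv (toℚ (coeff Q v))

  ratioPart-negative : ∀ e → coeffℚ (ratioPart Q v) e ≢ 0ℚ → Pos (0ᵛ -ᵛ K e)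
  ratioPart-negative e ≢0 =
    subst Pos (trans (cong (K v -ᵛ_) (key-+ₑ l e v)) (y-[x+y]≡0-x (K e) (K v))) (v-max (e +ₑ v) e+v∈Q e+v≢v)
    where
    φ : ℤ → ℚ
    φ c = - (toℚ c * iq)
    φ-+ : ∀ a b → φ (a ℤ.+ b) ≡ φ a + φ b
    φ-+ a b = trans (cong (λ x → - (x * iq)) (toℚ-+ a b))
                    (solve 3 (λ x y q → :- ((x :+ y) :* q) := :- (x :* q) :+ :- (y :* q)) refl (toℚ a) (toℚ b) iq)
    φ-0 : φ (+ 0) ≡ 0ℚ
    φ-0 = solve 1 (λ q → :- (con 0ℚ :* q) := con 0ℚ) refl iq
    without≢0 : coeff (without v Q) (e +ₑ v) ≢ + 0
    without≢0 c≡0 = ≢0 (trans (coeffℚ-shift v φ φ-+ φ-0 (λ _ → refl) (without v Q) e) (trans (cong φ c≡0) φ-0))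
    e+v≢v : e +ₑ v ≢ v
    e+v≢v e+v≡v = without≢0 (subst (λ k → coeff (without v Q) k ≡ + 0) (sym e+v≡v) (coeff-without-self v Q))
    e+v∈Q : InSupport Q (e +ₑ v)
    e+v∈Q = subst (_≢ + 0) (coeff-without-other v Q (e +ₑ v) e+v≢v) without≢0
    y-[x+y]≡0-x : ∀ {m} (x y : Vec ℚ m) → y -ᵛ (x +ᵛ y) ≡ 0ᵛ -ᵛ x
    y-[x+y]≡0-x [] [] = refl
    y-[x+y]≡0-x (a ∷ x) (b ∷ y) = cong₂ _∷_ (solve 2 (λ a b → b :- (a :+ b) := con 0ℚ :- a) refl a b) (y-[x+y]≡0-x x y)

  open GeometricSum (ratioPart Q v) K (key-+ₑ l) (key-0ₑ l) ratioPart-negative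

  shift : Exp n × ℤ → Exp n × ℚ
  shift (k , c) = k -ₑ v , toℚ c * iq

  P′ : QPoly n
  P′ = List.map shift P

  series : ℕ → QPoly n
  series = geomQ (ratioPart Q v)

  partialExpansion-coeff : ∀ M k → coeffℚ (partialExpansion P Q v M) k ≡ pairing P′ (λ e → coeffℚ (series M) (k -ₑ e))
  partialExpansion-coeff M k =
    trans (cong (λ X → coeffℚ (mulQ X (series M)) k) (ListP.map-cong (λ _ → refl) P)) (coeffℚ-mulQ P′ (series M) k)

  coeffℚ-P′ : ∀ e → coeffℚ P′ e ≡ toℚ (coeff P (e +ₑ v)) * iq
  coeffℚ-P′ = coeffℚ-shift v (λ c → toℚ c * iq) (λ a b → trans (cong (_* iq) (toℚ-+ a b)) (ℚP.*-distribʳ-+ iq (toℚ a) (toℚ b)))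
                           (ℚP.*-zeroˡ iq) (λ _ → refl) P

  P′-support : ∀ e → coeffℚ P′ e ≢ 0ℚ → InSupport P (e +ₑ v)
  P′-support e ≢0 c≡0 = ≢0 (trans (coeffℚ-P′ e) (trans (cong (λ c → toℚ c * iq) c≡0) (ℚP.*-zeroˡ iq)))

  pairing-series-vanishes : ∀ X M k → (∀ e → coeffℚ X e ≢ 0ℚ → Pos (K (k -ₑ e))) →
    pairing X (λ e → coeffℚ (series M) (k -ₑ e)) ≡ 0ℚ
  pairing-series-vanishes X M k pos with pairing X (λ e → coeffℚ (series M) (k -ₑ e)) ℚP.≟ 0ℚ
  ... | yes ≡0 = ≡0
  ... | no ≢0 with pairing≢0⇒ X _ ≢0
  ...   | e , X[e]≢0 , series≢0 = ⊥-elim (series≢0 (geomQ-positive M (k -ₑ e) (pos e X[e]≢0)))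

  t : Exp n
  t = w -ₑ v

  K[t-e] : ∀ e → K (t -ₑ e) ≡ K w -ᵛ K (e +ₑ v)
  K[t-e] e = trans (key--ₑ l t e) (trans (cong (_-ᵛ K e) (key--ₑ l w v))
                   (trans ([x-y]-z≡x-[z+y] (K w) (K v) (K e)) (cong (K w -ᵛ_) (sym (key-+ₑ l e v)))))
    where
    [x-y]-z≡x-[z+y] : ∀ {m} (x y z : Vec ℚ m) → (x -ᵛ y) -ᵛ z ≡ x -ᵛ (z +ᵛ y)
    [x-y]-z≡x-[z+y] [] [] [] = refl
    [x-y]-z≡x-[z+y] (a ∷ x) (b ∷ y) (c ∷ z) =
      cong₂ _∷_ (solve 3 (λ a b c → (a :- b) :- c := a :- (c :+ b)) refl a b c) ([x-y]-z≡x-[z+y] x y z)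

  -- For s ≥ 2 the first summand is positive and the second nonnegative, since w is key-maximal.
  K[st-e] : ∀ s e → K ((s ·ₑ t) -ₑ e) ≡ ((toℚ (+ s) - 1ℚ) ·ᵛ (K w -ᵛ K v)) +ᵛ (K w -ᵛ K (e +ₑ v))
  K[st-e] s e = trans (key--ₑ l (s ·ₑ t) e) (trans (cong₂ _-ᵛ_ (trans (key-·ₑ l s t) (cong (toℚ (+ s) ·ᵛ_) (key--ₑ l w v))) refl)
                      (trans (regroup (toℚ (+ s)) (K w) (K v) (K e)) (cong (λ y → ((toℚ (+ s) - 1ℚ) ·ᵛ (K w -ᵛ K v)) +ᵛ (K w -ᵛ y)) (sym (key-+ₑ l e v)))))
    where
    regroup : ∀ {m} σ (x y z : Vec ℚ m) → (σ ·ᵛ (x -ᵛ y)) -ᵛ z ≡ ((σ - 1ℚ) ·ᵛ (x -ᵛ y)) +ᵛ (x -ᵛ (z +ᵛ y))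
    regroup σ [] [] [] = refl
    regroup σ (a ∷ x) (b ∷ y) (c ∷ z) = cong₂ _∷_
      (solve 4 (λ σ a b c → σ :* (a :- b) :- c := (σ :- con 1ℚ) :* (a :- b) :+ (a :- (c :+ b))) refl σ a b c)
      (regroup σ x y z)

  coeff-at-t : ∀ M → coeffℚ (partialExpansion P Q v M) t ≡ toℚ (coeff P w) * iq
  coeff-at-t M = begin
    coeffℚ (partialExpansion P Q v M) t        ≡⟨ partialExpansion-coeff M t ⟩
    pairing P′ g                               ≡⟨ pairing-without t P′ g ⟩
    coeffℚ P′ t * g t + pairing (without t P′) g
      ≡⟨ cong₂ _+_ (cong₂ _*_ P′[t]≡ g[t]≡1) (pairing-series-vanishes (without t P′) M t pos) ⟩
    toℚ (coeff P w) * iq * 1ℚ + 0ℚ             ≡⟨ solve 1 (λ b → b :* con 1ℚ :+ con 0ℚ := b) refl (toℚ (coeff P w) * iq) ⟩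
    toℚ (coeff P w) * iq                       ∎
    where
    open ≡-Reasoning
    g : Exp n → ℚ
    g e = coeffℚ (series M) (t -ₑ e)
    P′[t]≡ : coeffℚ P′ t ≡ toℚ (coeff P w) * iq
    P′[t]≡ = trans (coeffℚ-P′ t) (cong (λ e → toℚ (coeff P e) * iq) ([k-v]+v≡k w v))
    g[t]≡1 : g t ≡ 1ℚ
    g[t]≡1 = trans (cong (coeffℚ (series M)) (-ₑ-inverse t)) (geomQ-0ₑ M)
    pos : ∀ e → coeffℚ (without t P′) e ≢ 0ℚ → Pos (K (t -ₑ e))
    pos e ≢0 with e ≟ₑ t
    ... | yes refl = ⊥-elim (≢0 (coeffℚ-without-self t P′))
    ... | no e≢t = subst Pos (sym (K[t-e] e)) (key-≤ₗ-≢⇒<ₗ l (w-max (e +ₑ v) e+v∈P) e+v≢w)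
      where
      e+v∈P : InSupport P (e +ₑ v)
      e+v∈P = P′-support e (subst (_≢ 0ℚ) (coeffℚ-without-other t P′ e e≢t) ≢0)
      e+v≢w : e +ₑ v ≢ w
      e+v≢w e+v≡w = e≢t (sym (proj₂ k-v≡e⇔k≡e+v (sym e+v≡w)))

  coeff-at-multiple : ∀ s → 2 ℕ.≤ s → ∀ M → coeffℚ (partialExpansion P Q v M) (s ·ₑ t) ≡ 0ℚ
  coeff-at-multiple s 2≤s M = trans (partialExpansion-coeff M (s ·ₑ t)) (pairing-series-vanishes P′ M (s ·ₑ t) pos)
    where
    0<s-1 : ∀ s → 2 ℕ.≤ s → 0ℚ < toℚ (+ s) - 1ℚ
    0<s-1 (suc zero) (ℕ.s≤s ())
    0<s-1 (suc (suc k)) _ = subst (0ℚ <_) (toℚ-- (+ suc (suc k)) (+ 1)) (ℚP.positive⁻¹ _ {{ℚP.normalize-pos (suc k) 1}})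
    pos : ∀ e → coeffℚ P′ e ≢ 0ℚ → Pos (K ((s ·ₑ t) -ₑ e))
    pos e ≢0 = subst Pos (sym (K[st-e] s e))
      (Pos-+ᵛ-NonNeg (Pos-·ᵛ (0<s-1 s 2≤s) (inj₁ (<⇒0<- lv<lw))) (w-max (e +ₑ v) (P′-support e ≢0)))

  ¬GaussProperty-expansion : ¬ GaussProperty (ExpCoeff P Q v)
  ¬GaussProperty-expansion = ¬GaussProperty (ExpCoeff P Q v) t (toℚ (coeff P w) * iq)
    (*-≢0 (toℚ≢0 w∈P) (inv-≢0 _ (toℚ≢0 v∈Q)))
    (0 , λ M _ → coeff-at-t M) (λ s 2≤s → 0 , λ M _ → coeff-at-multiple s 2≤s M)

separated⇒¬RatGauss : ∀ {n} (P Q : LaurentPoly n) → ¬ IsZeroPoly Q → ∀ a → InSupport P a → (l : Vec ℚ n) →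
  All (λ q → 0ℚ < dot l (toℚᵛ a -ᵛ toℚᵛ q)) (support Q) → ¬ RatGauss P Q
separated⇒¬RatGauss P Q Q≢0 a a∈P l sep gauss
  with ¬IsZeroPoly⇒InSupport Q Q≢0
... | q₀ , q₀∈Q with key-argmax l Q q₀ q₀∈Q | key-argmax l P a a∈P
...   | v , v∈Q , _ , v-max | w , w∈P , a≤w , w-max =
  Expansion.¬GaussProperty-expansion P Q l v v∈Q v-max′ w w∈P w-max lv<lw (gauss v (key-max⇒IsVertex Q l v v∈Q v-max′))
  where
  v-max′ : ∀ k → InSupport Q k → k ≢ v → key l k <ₗ key l v
  v-max′ k k∈Q = key-≤ₗ-≢⇒<ₗ l (v-max k k∈Q)
  V = dot l (toℚᵛ v)
  A = dot l (toℚᵛ a)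
  W = dot l (toℚᵛ w)
  lv<lw : V < W
  lv<lw = 0<-⇒< (subst (0ℚ <_) (solve 3 (λ w a v → (w :- a) :+ (a :- v) := w :- v) refl W A V)
    (ℚP.+-mono-≤-< (NonNeg-head a≤w)
                   (subst (0ℚ <_) (dot--ᵛ l (toℚᵛ a) (toℚᵛ v)) (All.lookup sep (InSupport⇒∈support Q v v∈Q)))))

proposition3p5 : (n : ℕ) (P Q : LaurentPoly n) → ¬ IsZeroPoly Q →
    RatGauss P Q → NewtonSubset P Q
proposition3p5 n P Q Q≢0 gauss = support⊆Newton⇒NewtonSubset P Q support⊆Newton
  where
  support⊆Newton : ∀ a → InSupport P a → InNewton Q (toℚᵛ a)
  support⊆Newton a a∈P with gordan n (InSupport Q) (λ q → toℚᵛ a -ᵛ toℚᵛ q) (support Q) (All-InSupport-support Q)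
  ... | inj₁ (l , separated) = ⊥-elim (separated⇒¬RatGauss P Q Q≢0 a a∈P l separated gauss)
  ... | inj₂ (ws , weights , 0<Σ , Σ≡0) = vanishing-combination⇒InNewton Q a ws weights 0<Σ Σ≡0
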